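{- For $n\ge1$, the map $g:\mathrm{NC}^{\mathrm{NN}}(n)\to\mathrm{LP}(n)$ is a bijection.
   Context: $[n]=\{1,\dots,n\}$. An edge of a partition of $[n]$ is a pair $(i,j)$, $i<j$, in the same block with no element of that block strictly between. $\mathrm{NC}(n)$: partitions of $[n]$ with no two edges $(a,b),(c,d)$, $a<c<b<d$. A block $B$ of $\sigma$ is nonnested if no edge $(i,j)$ has $i<\min B\le\max B<j$. $\mathrm{NC}^{\mathrm{NN}}(n)$ is the set of pairs $(\sigma,X)$ with $\sigma\in\mathrm{NC}(n)$ and $X$ a set of nonnested blocks of $\sigma$. $\mathrm{LP}(n)$ is the set of lattice paths from $(0,0)$ to $(n,n)$ with steps $U=(0,1)$ and $E=(1,0)$. For $\sigma\in\mathrm{NC}(n)$, its Dyck path $P(\sigma)$ has, for each $i\in[n]$, steps $2i-1$ and $2i$ equal to $UU$ if $i$ is the minimum of a non-singleton block, $EE$ if $i$ is the maximum of a non-singleton block, $UE$ if $\{i\}$ is a block, and $EU$ otherwise. For $(\sigma,X)\in\mathrm{NC}^{\mathrm{NN}}(n)$, $g(\sigma,X)$ is the path obtained from $P(\sigma)$ by, for each $B\in X$ with $i=\min B$, $j=\max B$, reflecting the subpath consisting of steps $2i-1,\dots,2j$ across the line $y=x$ (interchanging $U$ and $E$ in that subpath). -}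

module Defs where

open import Data.Nat as ℕ using (ℕ; _≤ᵇ_; _+_)
open import Data.Fin using (Fin; toℕ; _<_; _≤_)
open import Data.Bool using (Bool; true; false; T; not; _∧_; _∨_; _xor_; if_then_else_)
open import Data.Bool.ListAction using (all; any)
open import Data.List using (List; []; _∷_; _++_; allFin; concatMap; foldr; map; length; filter)
open import Data.Product using (_×_)
open import Data.Empty using (⊥)
open import Relation.Nullary using (¬_)
open import Relation.Binary.PropositionalEquality using (_≡_)

-- Elements of [n] are represented by Fin n (element k+1 of [n] is the Fin value k);
-- the order on [n] is the order on Fin n (via toℕ).

-- A set partition σ of [n] is given by its (decidable) equivalence relation
-- "i and j lie in the same block" : R i j = true.
Rel : ℕ → Set
Rel n = Fin n → Fin n → Bool

IsEquivalence : ∀ {n} → Rel n → Set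
IsEquivalence {n} R =
  ((i : Fin n) → T (R i i)) ×
  ((i j : Fin n) → T (R i j) → T (R j i)) ×
  ((i j k : Fin n) → T (R i j) → T (R j k) → T (R i k))

Edge : ∀ {n} → Rel n → Fin n → Fin n → Set
Edge {n} R i j =
  (i < j) × T (R i j) × ((k : Fin n) → i < k → k < j → ¬ T (R i k))

NonCrossing : ∀ {n} → Rel n → Set
NonCrossing {n} R = (a b c d : Fin n) → Edge R a b → Edge R c d →
  a < c → c < b → b < d → ⊥

IsMinOfBlock : ∀ {n} → Rel n → Fin n → Set
IsMinOfBlock {n} R i = (k : Fin n) → T (R i k) → i ≤ k

IsMaxOfBlock : ∀ {n} → Rel n → Fin n → Set
IsMaxOfBlock {n} R i = (k : Fin n) → T (R i k) → k ≤ i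

NonNestedBlock : ∀ {n} → Rel n → Fin n → Set
NonNestedBlock {n} R m = (i j M : Fin n) → Edge R i j → T (R m M) → IsMaxOfBlock R M →
  i < m → M < j → ⊥

-- A set X of blocks is encoded by the indicator of the minima of its blocks:
-- X m = true iff m is the minimum of a block belonging to X.
-- (σ , X) ∈ NC^NN(n):
ValidNCNN : ∀ {n} → Rel n → (Fin n → Bool) → Set
ValidNCNN {n} R X =
  IsEquivalence R × NonCrossing R ×
  ((m : Fin n) → T (X m) → IsMinOfBlock R m × NonNestedBlock R m)

-- Lattice paths: lists of steps U = (0,1), E = (1,0).
data Step : Set where
  U E : Step

Path : Set
Path = List Step

countU : Path → ℕ
countU [] = 0
countU (U ∷ p) = ℕ.suc (countU p)
countU (E ∷ p) = countU p

-- LP(n): paths from (0,0) to (n,n), i.e. 2n steps of which n are U (and hence n are E).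
InLP : ℕ → Path → Set
InLP n p = (length p ≡ n + n) × (countU p ≡ n)

leᵇ : ∀ {n} → Fin n → Fin n → Bool
leᵇ i j = toℕ i ≤ᵇ toℕ j

isMinᵇ : ∀ {n} → Rel n → Fin n → Bool
isMinᵇ {n} R i = all (λ k → not (R i k) ∨ leᵇ i k) (allFin n)

isMaxᵇ : ∀ {n} → Rel n → Fin n → Bool
isMaxᵇ {n} R i = all (λ k → not (R i k) ∨ leᵇ k i) (allFin n)

-- Steps 2i-1, 2i of the Dyck path P(σ).
dyckSteps : ∀ {n} → Rel n → Fin n → Path
dyckSteps R i with isMinᵇ R i | isMaxᵇ R i
... | true  | false = U ∷ U ∷ []
... | false | true  = E ∷ E ∷ []
... | true  | true  = U ∷ E ∷ []
... | false | false = E ∷ U ∷ []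

dyckPath : ∀ {n} → Rel n → Path
dyckPath {n} R = concatMap (dyckSteps R) (allFin n)

covers : ∀ {n} → Rel n → (Fin n → Bool) → Fin n → Fin n → Bool
covers {n} R X m i = X m ∧ leᵇ m i ∧ any (λ k → R m k ∧ leᵇ i k) (allFin n)

-- Steps 2i-1, 2i lie in the reflected subpath of B exactly when min B ≤ i ≤ max B.
-- Performing all the reflections (B ∈ X) swaps U/E at these steps once per such B,
-- so the net effect is a swap iff an odd number of blocks of X cover i.
flipParity : ∀ {n} → Rel n → (Fin n → Bool) → Fin n → Bool
flipParity {n} R X i = foldr (λ m b → covers R X m i xor b) false (allFin n)

swap : Step → Step
swap U = E
swap E = U

gSteps : ∀ {n} → Rel n → (Fin n → Bool) → Fin n → Path
gSteps R X i = if flipParity R X i then map swap (dyckSteps R i) else dyckSteps R i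

g : ∀ {n} → Rel n → (Fin n → Bool) → Path
g {n} R X = concatMap (gSteps R X) (allFin n)

module Submission where

-- Each element i of [n] contributes two steps to g(σ,X), determined by its
-- kind (minimum, maximum, singleton or inner element of its block) and by
-- whether it is reflected.  Record these as a word of letters.  Since the
-- blocks of X are nonnested, every reflected stretch is the span of an
-- outermost block; hence the words that occur are exactly the "balanced"
-- words of a small automaton that tracks the nesting depth inside the span of
-- an outermost block and requires a constant flip bit there.
--
-- Induction on n then gives that ground-level
-- prefixes are exactly the cuts of the partition, that the word determines
-- (σ,X), and that every balanced word arises.

open import Defs
open import Data.Nat using (ℕ; _≤_)
open import Data.Fin using (Fin)
open import Data.Bool using (Bool)
open import Data.Product using (_×_; ∃; ∃-syntax)
open import Relation.Binary.PropositionalEquality using (_≡_)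

open import Data.Nat using (zero; suc; _+_; _<_; _<ᵇ_; z≤n; s≤s)
open import Data.Fin as F using (toℕ)
import Data.Fin.Properties as FP
import Data.Nat.Properties as ℕP
import Data.Bool.Properties as Boolₚ
open import Data.Nat.Tactic.RingSolver using (solve-∀)
open import Data.Bool using (true; false; T; not; _∧_; _∨_; _xor_)
open import Data.List using (List; []; _∷_; _++_; map; length; take; drop; tabulate; allFin; concatMap; foldr)
open import Data.Bool.ListAction using (all; any)
import Data.List.Properties as LP
open import Data.List.Relation.Unary.All using (All; []; _∷_)
import Data.List.Relation.Unary.All.Properties as Allₚ
import Data.List.Relation.Unary.Any.Properties as Anyₚ
open import Data.Sum using (_⊎_; inj₁; inj₂)
open import Data.Product using (Σ; _,_; proj₁; proj₂)
open import Data.Unit using (tt)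
open import Data.Empty using (⊥-elim)
open import Relation.Nullary using (¬_; yes; no)
open import Relation.Binary.Definitions using (tri<; tri≈; tri>)
open import Function using (case_of_)
open import Relation.Binary.PropositionalEquality using (_≢_; refl; sym; trans; cong; cong₂; subst; module ≡-Reasoning)

-- The kind of an element of [n]: minimum of a non-singleton block, maximum
-- of a non-singleton block, singleton block, or none of these.
data Kind : Set where
  opener closer singleton inner : Kind

-- A letter is a kind together with a flip bit (is the element reflected?).
Letter : Set
Letter = Kind × Bool

Word : Set
Word = List Letter

kindSteps : Kind → Path
kindSteps opener    = U ∷ U ∷ []
kindSteps closer    = E ∷ E ∷ []
kindSteps singleton = U ∷ E ∷ []
kindSteps inner     = E ∷ U ∷ []

letterPath : Letter → Path
letterPath (κ , false) = kindSteps κ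
letterPath (κ , true)  = map swap (kindSteps κ)

wordPath : Word → Path
wordPath []      = []
wordPath (x ∷ w) = letterPath x ++ wordPath w

length-letterPath : ∀ x → length (letterPath x) ≡ 2
length-letterPath (opener    , false) = refl
length-letterPath (closer    , false) = refl
length-letterPath (singleton , false) = refl
length-letterPath (inner     , false) = refl
length-letterPath (opener    , true)  = refl
length-letterPath (closer    , true)  = refl
length-letterPath (singleton , true)  = refl
length-letterPath (inner     , true)  = refl

length-wordPath : ∀ w → length (wordPath w) ≡ length w + length w
length-wordPath [] = refl
length-wordPath (x ∷ w) = begin
  length (letterPath x ++ wordPath w)          ≡⟨ LP.length-++ (letterPath x) ⟩
  length (letterPath x) + length (wordPath w)  ≡⟨ cong₂ _+_ (length-letterPath x) (length-wordPath w) ⟩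
  suc (suc (length w + length w))              ≡⟨ cong suc (sym (ℕP.+-suc (length w) (length w))) ⟩
  suc (length w + suc (length w))              ∎
  where open ≡-Reasoning

-- Reading a word from left to right we are either at ground level, or inside
-- an arch (a maximal stretch enclosed by some block) at nesting depth d whose
-- letters must all carry the arch's flip bit b, or dead after an illegal letter.
data State : Set where
  ground : State
  arch   : ℕ → Bool → State
  dead   : State

archStep : ℕ → Bool → Kind → State
archStep d       b opener    = arch (suc d) b
archStep zero    b closer    = ground
archStep (suc d) b closer    = arch d b
archStep d       b singleton = arch d b
archStep d       b inner     = arch d b

step : State → Letter → State
step ground (opener , b)    = arch 0 b
step ground (singleton , b) = ground
step ground (closer , b)    = dead
step ground (inner , b)     = dead
step (arch d true)  (κ , true)  = archStep d true κ
step (arch d false) (κ , false) = archStep d false κ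
step (arch d true)  (κ , false) = dead
step (arch d false) (κ , true)  = dead
step dead x = dead

run : State → Word → State
run s []      = s
run s (x ∷ w) = run (step s x) w

Balanced : Word → Set
Balanced w = run ground w ≡ ground

run-dead : ∀ w → run dead w ≡ dead
run-dead []      = refl
run-dead (x ∷ w) = run-dead w

run-++ : ∀ s u v → run s (u ++ v) ≡ run (run s u) v
run-++ s []      v = refl
run-++ s (x ∷ u) v = run-++ (step s x) u v

step-alive : ∀ s x w → run s (x ∷ w) ≢ dead → step s x ≢ dead
step-alive s x w alive eq = alive (trans (cong (λ t → run t w) eq) (run-dead w))

prefix-alive : ∀ s w q → run s w ≢ dead → run s (take q w) ≢ dead
prefix-alive s w q alive eq = alive (begin
  run s w                                ≡⟨ cong (run s) (sym (LP.take++drop≡id q w)) ⟩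
  run s (take q w ++ drop q w)           ≡⟨ run-++ s (take q w) (drop q w) ⟩
  run (run s (take q w)) (drop q w)      ≡⟨ cong (λ t → run t (drop q w)) eq ⟩
  run dead (drop q w)                    ≡⟨ run-dead (drop q w) ⟩
  dead                                   ∎)
  where open ≡-Reasoning

balanced-alive : ∀ {w} → Balanced w → run ground w ≢ dead
balanced-alive bal eq with trans (sym bal) eq
... | ()

archStep-alive : ∀ d b κ → archStep d b κ ≢ dead
archStep-alive d       b opener    ()
archStep-alive zero    b closer    ()
archStep-alive (suc d) b closer    ()
archStep-alive d       b singleton ()
archStep-alive d       b inner     ()

-- Inside an unflipped arch of depth d the path is d+1 up-steps above the
-- diagonal; inside a flipped one it is d+1 steps below.
excessU excessE : State → ℕ
excessU (arch d false) = suc d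
excessU _              = 0
excessE (arch d true)  = suc d
excessE _              = 0

countU-++ : ∀ p q → countU (p ++ q) ≡ countU p + countU q
countU-++ []      q = refl
countU-++ (U ∷ p) q = cong suc (countU-++ p q)
countU-++ (E ∷ p) q = countU-++ p q

countU-letter : ∀ s x → step s x ≢ dead →
  countU (letterPath x) + excessU s + excessE (step s x) ≡ 1 + excessU (step s x) + excessE s
countU-letter ground (opener , false)    alive = refl
countU-letter ground (opener , true)     alive = refl
countU-letter ground (singleton , false) alive = refl
countU-letter ground (singleton , true)  alive = refl
countU-letter ground (closer , b)        alive = ⊥-elim (alive refl)
countU-letter ground (inner , b)         alive = ⊥-elim (alive refl)
countU-letter (arch d true)  (κ , false) alive = ⊥-elim (alive refl)
countU-letter (arch d false) (κ , true)  alive = ⊥-elim (alive refl)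
countU-letter (arch d       false) (opener , false)    alive = refl
countU-letter (arch zero    false) (closer , false)    alive = refl
countU-letter (arch (suc d) false) (closer , false)    alive = refl
countU-letter (arch d       false) (singleton , false) alive = refl
countU-letter (arch d       false) (inner , false)     alive = refl
countU-letter (arch d       true)  (opener , true)     alive = refl
countU-letter (arch zero    true)  (closer , true)     alive = refl
countU-letter (arch (suc d) true)  (closer , true)     alive = refl
countU-letter (arch d       true)  (singleton , true)  alive = refl
countU-letter (arch d       true)  (inner , true)      alive = refl
countU-letter dead x alive = ⊥-elim (alive refl)

countU-wordPath : ∀ s w → run s w ≢ dead →
  countU (wordPath w) + excessU s + excessE (run s w) ≡ length w + excessU (run s w) + excessE s
countU-wordPath s [] alive = refl
countU-wordPath s (x ∷ w) alive =
  ℕP.+-cancelʳ-≡ (excessU s′ + excessE s′) _ _ (begin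
    countU (letterPath x ++ wordPath w) + excessU s + excessE t + (excessU s′ + excessE s′)
      ≡⟨ cong (λ c → c + excessU s + excessE t + (excessU s′ + excessE s′))
              (countU-++ (letterPath x) (wordPath w)) ⟩
    countU (letterPath x) + countU (wordPath w) + excessU s + excessE t + (excessU s′ + excessE s′)
      ≡⟨ regroup (countU (letterPath x)) (countU (wordPath w)) (excessU s) (excessE t)
                 (excessU s′) (excessE s′) ⟩
    (countU (letterPath x) + excessU s + excessE s′) + (countU (wordPath w) + excessU s′ + excessE t)
      ≡⟨ cong₂ _+_ (countU-letter s x (step-alive s x w alive)) (countU-wordPath s′ w alive) ⟩
    (1 + excessU s′ + excessE s) + (length w + excessU t + excessE s′)
      ≡⟨ regroup′ (excessU s′) (excessE s) (length w) (excessU t) (excessE s′) ⟩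
    suc (length w) + excessU t + excessE s + (excessU s′ + excessE s′) ∎)
  where
  open ≡-Reasoning
  s′ t : State
  s′ = step s x
  t  = run s′ w
  regroup : ∀ a b c d e f → a + b + c + d + (e + f) ≡ (a + c + f) + (b + e + d)
  regroup = solve-∀
  regroup′ : ∀ e f l u g → (1 + e + f) + (l + u + g) ≡ suc l + u + f + (e + g)
  regroup′ = solve-∀

countU-balanced : ∀ w → Balanced w → countU (wordPath w) ≡ length w
countU-balanced w bal = ℕP.+-cancelʳ-≡ 0 _ _ (ℕP.+-cancelʳ-≡ 0 _ _ atGround)
  where
  atGround : countU (wordPath w) + 0 + 0 ≡ length w + 0 + 0
  atGround = subst (λ t → countU (wordPath w) + 0 + excessE t ≡ length w + excessU t + 0) bal
                   (countU-wordPath ground w (balanced-alive {w} bal))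

balanced-countU : ∀ w → run ground w ≢ dead → countU (wordPath w) ≡ length w → Balanced w
balanced-countU w alive cnt = atGround (run ground w) alive (begin
  length w + excessE (run ground w)
    ≡⟨ cong (λ c → c + excessE (run ground w)) (sym (trans (ℕP.+-identityʳ _) cnt)) ⟩
  countU (wordPath w) + 0 + excessE (run ground w)
    ≡⟨ countU-wordPath ground w alive ⟩
  length w + excessU (run ground w) + 0
    ≡⟨ ℕP.+-identityʳ _ ⟩
  length w + excessU (run ground w) ∎)
  where
  open ≡-Reasoning
  atGround : ∀ t → t ≢ dead → length w + excessE t ≡ length w + excessU t → t ≡ ground
  atGround ground         _     _ = refl
  atGround (arch d false) _     e = ⊥-elim (ℕP.0≢1+n (ℕP.+-cancelˡ-≡ (length w) _ _ e))
  atGround (arch d true)  _     e = ⊥-elim (ℕP.0≢1+n (sym (ℕP.+-cancelˡ-≡ (length w) _ _ e)))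
  atGround dead           alive _ = ⊥-elim (alive refl)

kindOf : Step → Step → Kind
kindOf U U = opener
kindOf E E = closer
kindOf U E = singleton
kindOf E U = inner

-- The state decides how two steps are read: inside an arch the flip bit is
-- forced, at ground level it is determined by the steps themselves.
decodeLetter : State → Step → Step → Letter
decodeLetter ground U U = (opener , false)
decodeLetter ground E E = (opener , true)
decodeLetter ground U E = (singleton , false)
decodeLetter ground E U = (singleton , true)
decodeLetter (arch d false) x y = (kindOf x y , false)
decodeLetter (arch d true)  x y = (kindOf (swap x) (swap y) , true)
decodeLetter dead x y = (singleton , false)

decode : State → Path → Word
decode s []          = []
decode s (x ∷ [])    = []
decode s (x ∷ y ∷ p) = decodeLetter s x y ∷ decode (step s (decodeLetter s x y)) p

decodeLetter-sound : ∀ s x y → s ≢ dead →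
  (step s (decodeLetter s x y) ≢ dead) × (letterPath (decodeLetter s x y) ≡ x ∷ y ∷ [])
decodeLetter-sound ground U U _ = (λ ()) , refl
decodeLetter-sound ground E E _ = (λ ()) , refl
decodeLetter-sound ground U E _ = (λ ()) , refl
decodeLetter-sound ground E U _ = (λ ()) , refl
decodeLetter-sound (arch d false) U U _ = archStep-alive d false opener , refl
decodeLetter-sound (arch d false) E E _ = archStep-alive d false closer , refl
decodeLetter-sound (arch d false) U E _ = archStep-alive d false singleton , refl
decodeLetter-sound (arch d false) E U _ = archStep-alive d false inner , refl
decodeLetter-sound (arch d true)  U U _ = archStep-alive d true closer , refl
decodeLetter-sound (arch d true)  E E _ = archStep-alive d true opener , refl
decodeLetter-sound (arch d true)  U E _ = archStep-alive d true inner , refl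
decodeLetter-sound (arch d true)  E U _ = archStep-alive d true singleton , refl
decodeLetter-sound dead x y alive = ⊥-elim (alive refl)

decode-sound : ∀ n s p → s ≢ dead → length p ≡ n + n →
  (wordPath (decode s p) ≡ p) × (length (decode s p) ≡ n) × (run s (decode s p) ≢ dead)
decode-sound zero s [] alive _ = refl , refl , alive
decode-sound (suc n) s (x ∷ []) alive len =
  ⊥-elim (ℕP.0≢1+n (trans (ℕP.suc-injective len) (ℕP.+-suc n n)))
decode-sound (suc n) s (x ∷ y ∷ p) alive len
  with decodeLetter-sound s x y alive
... | legal , steps with decode-sound n (step s (decodeLetter s x y)) p legal
                           (ℕP.suc-injective (trans (ℕP.suc-injective len) (ℕP.+-suc n n)))
...   | pathEq , lengthEq , alive′ = cong₂ _++_ steps pathEq , cong suc lengthEq , alive′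

decode-wordPath : ∀ s w → run s w ≢ dead → decode s (wordPath w) ≡ w
decode-wordPath s [] alive = refl
decode-wordPath s (x ∷ w) alive =
  trans (decode-letter s x (step-alive s x w alive)) (cong (x ∷_) (decode-wordPath (step s x) w alive))
  where
  decode-letter : ∀ s x {q} → step s x ≢ dead → decode s (letterPath x ++ q) ≡ x ∷ decode (step s x) q
  decode-letter ground (opener , false)    alive = refl
  decode-letter ground (opener , true)     alive = refl
  decode-letter ground (singleton , false) alive = refl
  decode-letter ground (singleton , true)  alive = refl
  decode-letter ground (closer , b)        alive = ⊥-elim (alive refl)
  decode-letter ground (inner , b)         alive = ⊥-elim (alive refl)
  decode-letter (arch d false) (opener , false)    alive = refl
  decode-letter (arch d false) (closer , false)    alive = refl
  decode-letter (arch d false) (singleton , false) alive = refl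
  decode-letter (arch d false) (inner , false)     alive = refl
  decode-letter (arch d true)  (opener , true)     alive = refl
  decode-letter (arch d true)  (closer , true)     alive = refl
  decode-letter (arch d true)  (singleton , true)  alive = refl
  decode-letter (arch d true)  (inner , true)      alive = refl
  decode-letter (arch d false) (κ , true)  alive = ⊥-elim (alive refl)
  decode-letter (arch d true)  (κ , false) alive = ⊥-elim (alive refl)
  decode-letter dead x alive = ⊥-elim (alive refl)

wordPath-injective : ∀ w w′ → run ground w ≢ dead → run ground w′ ≢ dead →
  wordPath w ≡ wordPath w′ → w ≡ w′
wordPath-injective w w′ alive alive′ eq = begin
  w                            ≡⟨ sym (decode-wordPath ground w alive) ⟩
  decode ground (wordPath w)   ≡⟨ cong (decode ground) eq ⟩
  decode ground (wordPath w′)  ≡⟨ decode-wordPath ground w′ alive′ ⟩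
  w′                           ∎
  where open ≡-Reasoning

data IsMinKind : Kind → Set where
  opener    : IsMinKind opener
  singleton : IsMinKind singleton

ground-IsMinKind : ∀ x → step ground x ≢ dead → IsMinKind (proj₁ x)
ground-IsMinKind (opener , b)    _     = opener
ground-IsMinKind (singleton , b) _     = singleton
ground-IsMinKind (closer , b)    alive = ⊥-elim (alive refl)
ground-IsMinKind (inner , b)     alive = ⊥-elim (alive refl)

flipBy : Bool → Letter → Letter
flipBy c (κ , b) = (κ , b xor c)

-- The letter of a block minimum after a new, smaller element joins its block.
loseMin : Letter → Letter
loseMin (opener , b)    = (inner , b)
loseMin (singleton , b) = (closer , b)
loseMin (closer , b)    = (closer , b)
loseMin (inner , b)     = (inner , b)

Unflipped : Word → Set
Unflipped = All (λ x → proj₂ x ≡ false)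

-- If the element at position |u| of the word u ++ x ∷ v is a block minimum, a
-- new first element joined to its block produces this word: the new element
-- opens an arch with flip bit b, which covers u, and x loses its minimality.
joinWord : Bool → Word → Letter → Word → Word
joinWord b u x v = (opener , b) ∷ (map (flipBy b) u ++ loseMin x ∷ v)

-- The state reached when a run from ground level is put inside a new arch.
nest : State → Bool → State
nest ground         c = arch 0 c
nest (arch d false) c = arch (suc d) c
nest (arch d true)  c = dead
nest dead           c = dead

nest-not-ground : ∀ s c → nest s c ≢ ground
nest-not-ground ground         c ()
nest-not-ground (arch d false) c ()
nest-not-ground (arch d true)  c ()
nest-not-ground dead           c ()

nest-step : ∀ s κ c → step s (κ , false) ≢ dead → step (nest s c) (κ , c) ≡ nest (step s (κ , false)) c
nest-step ground opener    false _ = refl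
nest-step ground opener    true  _ = refl
nest-step ground singleton false _ = refl
nest-step ground singleton true  _ = refl
nest-step ground closer    c alive = ⊥-elim (alive refl)
nest-step ground inner     c alive = ⊥-elim (alive refl)
nest-step (arch d       false) opener    false _ = refl
nest-step (arch d       false) opener    true  _ = refl
nest-step (arch zero    false) closer    false _ = refl
nest-step (arch zero    false) closer    true  _ = refl
nest-step (arch (suc d) false) closer    false _ = refl
nest-step (arch (suc d) false) closer    true  _ = refl
nest-step (arch d       false) singleton false _ = refl
nest-step (arch d       false) singleton true  _ = refl
nest-step (arch d       false) inner     false _ = refl
nest-step (arch d       false) inner     true  _ = refl
nest-step (arch d true) κ c alive = ⊥-elim (alive refl)
nest-step dead          κ c alive = ⊥-elim (alive refl)

run-nest : ∀ u s c → Unflipped u → run s u ≢ dead → run (nest s c) (map (flipBy c) u) ≡ nest (run s u) c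
run-nest [] s c [] alive = refl
run-nest ((κ , false) ∷ u) s c (refl ∷ unf) alive = begin
  run (step (nest s c) (κ , c)) (map (flipBy c) u)
    ≡⟨ cong (λ t → run t (map (flipBy c) u)) (nest-step s κ c (step-alive s _ u alive)) ⟩
  run (nest (step s (κ , false)) c) (map (flipBy c) u)
    ≡⟨ run-nest u (step s (κ , false)) c unf alive ⟩
  nest (run s ((κ , false) ∷ u)) c ∎
  where open ≡-Reasoning

take-++-≤ : ∀ {A : Set} q (xs ys : List A) → q ≤ length xs → take q (xs ++ ys) ≡ take q xs
take-++-≤ zero    xs       ys _         = refl
take-++-≤ (suc q) (x ∷ xs) ys (s≤s le) = cong (x ∷_) (take-++-≤ q xs ys le)

take-++-+ : ∀ {A : Set} (xs ys : List A) r → take (length xs + r) (xs ++ ys) ≡ xs ++ take r ys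
take-++-+ []       ys r = refl
take-++-+ (x ∷ xs) ys r = cong (x ∷_) (take-++-+ xs ys r)

-- Where the original word read the minimum x, the join word closes or continues its arch.
loseMin-step : ∀ {κ} b → IsMinKind κ → step (arch 0 b) (loseMin (κ , b)) ≡ step ground (κ , b)
loseMin-step false opener    = refl
loseMin-step true  opener    = refl
loseMin-step false singleton = refl
loseMin-step true  singleton = refl

module JoinWord (b : Bool) (u : Word) (κ : Kind) (v : Word)
                (bal : Balanced u) (unf : Unflipped u) (min : IsMinKind κ) where

  private
    alive : run ground u ≢ dead
    alive = balanced-alive {u} bal

  run-joinWord : ∀ v′ → run ground (joinWord b u (κ , b) v′) ≡ run ground (u ++ (κ , b) ∷ v′)
  run-joinWord v′ = begin
    run (arch 0 b) (map (flipBy b) u ++ loseMin (κ , b) ∷ v′)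
      ≡⟨ run-++ (arch 0 b) (map (flipBy b) u) _ ⟩
    run (run (nest ground b) (map (flipBy b) u)) (loseMin (κ , b) ∷ v′)
      ≡⟨ cong (λ t → run t (loseMin (κ , b) ∷ v′)) (run-nest u ground b unf alive) ⟩
    run (nest (run ground u) b) (loseMin (κ , b) ∷ v′)
      ≡⟨ cong (λ t → run (nest t b) (loseMin (κ , b) ∷ v′)) bal ⟩
    run (step (arch 0 b) (loseMin (κ , b))) v′
      ≡⟨ cong (λ t → run t v′) (loseMin-step b min) ⟩
    run (step ground (κ , b)) v′
      ≡⟨ cong (λ t → run t ((κ , b) ∷ v′)) (sym bal) ⟩
    run (run ground u) ((κ , b) ∷ v′)
      ≡⟨ sym (run-++ ground u _) ⟩
    run ground (u ++ (κ , b) ∷ v′) ∎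
    where open ≡-Reasoning

  joinWord-early : ∀ q → q ≤ length u →
    run ground (take (suc q) (joinWord b u (κ , b) v)) ≡ nest (run ground (take q u)) b
  joinWord-early q le = begin
    run (arch 0 b) (take q (map (flipBy b) u ++ loseMin (κ , b) ∷ v))
      ≡⟨ cong (run (arch 0 b)) (take-++-≤ q (map (flipBy b) u) _
                                 (subst (q ≤_) (sym (LP.length-map (flipBy b) u)) le)) ⟩
    run (arch 0 b) (take q (map (flipBy b) u))
      ≡⟨ cong (run (arch 0 b)) (LP.take-map q u) ⟩
    run (nest ground b) (map (flipBy b) (take q u))
      ≡⟨ run-nest (take q u) ground b (Allₚ.take⁺ q unf) (prefix-alive ground u q alive) ⟩
    nest (run ground (take q u)) b ∎
    where open ≡-Reasoning

  joinWord-late : ∀ r → run ground (take (suc (length u + suc r)) (joinWord b u (κ , b) v))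
                      ≡ run ground (take (length u + suc r) (u ++ (κ , b) ∷ v))
  joinWord-late r = begin
    run (arch 0 b) (take (length u + suc r) (map (flipBy b) u ++ loseMin (κ , b) ∷ v))
      ≡⟨ cong (λ l → run (arch 0 b) (take (l + suc r) (map (flipBy b) u ++ loseMin (κ , b) ∷ v)))
              (sym (LP.length-map (flipBy b) u)) ⟩
    run (arch 0 b) (take (length (map (flipBy b) u) + suc r) (map (flipBy b) u ++ loseMin (κ , b) ∷ v))
      ≡⟨ cong (run (arch 0 b)) (take-++-+ (map (flipBy b) u) _ (suc r)) ⟩
    run (arch 0 b) (map (flipBy b) u ++ loseMin (κ , b) ∷ take r v)
      ≡⟨ run-joinWord (take r v) ⟩
    run ground (u ++ (κ , b) ∷ take r v)
      ≡⟨ cong (run ground) (sym (take-++-+ u _ (suc r))) ⟩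
    run ground (take (length u + suc r) (u ++ (κ , b) ∷ v)) ∎
    where open ≡-Reasoning

  joinWord-beyond : ∀ q → length u < q →
    run ground (take (suc q) (joinWord b u (κ , b) v)) ≡ run ground (take q (u ++ (κ , b) ∷ v))
  joinWord-beyond q lt with ℕP.m≤n⇒∃[o]m+o≡n lt
  ... | r , refl = subst (λ l → run ground (take (suc l) (joinWord b u (κ , b) v))
                                ≡ run ground (take l (u ++ (κ , b) ∷ v)))
                         (ℕP.+-suc (length u) r) (joinWord-late r)

  joinWord-prefix⇒ : ∀ q → length u < q → run ground (take q (u ++ (κ , b) ∷ v)) ≡ ground →
    run ground (take (suc q) (joinWord b u (κ , b) v)) ≡ ground
  joinWord-prefix⇒ q lt atGround = trans (joinWord-beyond q lt) atGround

  joinWord-prefix⇐ : ∀ q → run ground (take (suc q) (joinWord b u (κ , b) v)) ≡ ground →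
    (length u < q) × (run ground (take q (u ++ (κ , b) ∷ v)) ≡ ground)
  joinWord-prefix⇐ q atGround with ℕP.≤-<-connex q (length u)
  ... | inj₁ le = ⊥-elim (nest-not-ground _ b (trans (sym (joinWord-early q le)) atGround))
  ... | inj₂ lt = lt , trans (sym (joinWord-beyond q lt)) atGround

loseMin-not-min : ∀ {κ b} → IsMinKind κ → ¬ IsMinKind (proj₁ (loseMin (κ , b)))
loseMin-not-min opener    ()
loseMin-not-min singleton ()

loseMin-injective : ∀ {κ κ′ b} → IsMinKind κ → IsMinKind κ′ → loseMin (κ , b) ≡ loseMin (κ′ , b) → κ ≡ κ′
loseMin-injective opener    opener    _ = refl
loseMin-injective singleton singleton _ = refl

-- The arch opened by a join word ends at the first letter that is not read
-- as a block minimum at ground level, so u, x and v can be recovered.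
joinTail-injective : ∀ s u u′ {κ κ′ v v′ b} → run s u ≡ ground → run s u′ ≡ ground →
  Unflipped u → Unflipped u′ → IsMinKind κ → IsMinKind κ′ →
  map (flipBy b) u ++ loseMin (κ , b) ∷ v ≡ map (flipBy b) u′ ++ loseMin (κ′ , b) ∷ v′ →
  (u ≡ u′) × (κ ≡ κ′) × (v ≡ v′)
joinTail-injective s [] [] _ _ _ _ min min′ eq =
  refl , loseMin-injective min min′ (LP.∷-injectiveˡ eq) , LP.∷-injectiveʳ eq
joinTail-injective s [] (y ∷ u′) refl bal′ _ (refl ∷ _) min _ eq =
  ⊥-elim (loseMin-not-min min (subst IsMinKind (sym (cong proj₁ (LP.∷-injectiveˡ eq)))
                                (ground-IsMinKind y (step-alive ground y u′ (balanced-alive {y ∷ u′} bal′)))))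
joinTail-injective s (y ∷ u) [] bal refl (refl ∷ _) _ _ min′ eq =
  ⊥-elim (loseMin-not-min min′ (subst IsMinKind (cong proj₁ (LP.∷-injectiveˡ eq))
                                 (ground-IsMinKind y (step-alive ground y u (balanced-alive {y ∷ u} bal)))))
joinTail-injective s ((κ , false) ∷ u) ((κ′ , false) ∷ u′) bal bal′ (refl ∷ unf) (refl ∷ unf′) min min′ eq
  with LP.∷-injective eq
... | refl , eq′ with joinTail-injective (step s (κ , false)) u u′ bal bal′ unf unf′ min min′ eq′
... | refl , κ≡κ′ , v≡v′ = refl , κ≡κ′ , v≡v′

joinWord-injective : ∀ {b b′ u u′ κ κ′ v v′} → Balanced u → Balanced u′ → Unflipped u → Unflipped u′ →
  IsMinKind κ → IsMinKind κ′ → joinWord b u (κ , b) v ≡ joinWord b′ u′ (κ′ , b′) v′ →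
  (b ≡ b′) × (u ≡ u′) × (κ ≡ κ′) × (v ≡ v′)
joinWord-injective {u = u} {u′} bal bal′ unf unf′ min min′ eq with LP.∷-injective eq
... | refl , eq′ = refl , joinTail-injective ground u u′ bal bal′ unf unf′ min min′ eq′

-- The state which nest turns into an arch of depth d: nest (unnest d) b ≡ arch d b.
unnest : ℕ → State
unnest zero    = ground
unnest (suc d) = arch d false

-- A word leading from inside an arch back to ground level, cut where the arch closes.
record ArchExit (d : ℕ) (b : Bool) (w : Word) : Set where
  field
    inside  : Word
    kind    : Kind
    outside : Word
    minKind : IsMinKind kind
    split   : w ≡ map (flipBy b) inside ++ loseMin (kind , b) ∷ outside
    insideUnflipped : Unflipped inside
    insideRun       : run (unnest d) inside ≡ ground
    outsideBalanced : Balanced ((kind , b) ∷ outside)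

extendExit : ∀ {d d′ b κ w} → step (unnest d) (κ , false) ≡ unnest d′ → ArchExit d′ b w → ArchExit d b ((κ , b) ∷ w)
extendExit {κ = κ} st e = record
  { inside = (κ , false) ∷ inside ; kind = kind ; outside = outside ; minKind = minKind
  ; split = cong (_ ∷_) split
  ; insideUnflipped = refl ∷ insideUnflipped
  ; insideRun = trans (cong (λ t → run t inside) st) insideRun
  ; outsideBalanced = outsideBalanced }
  where open ArchExit e

archExit : ∀ d b w → run (arch d b) w ≡ ground → ArchExit d b w
archExitFrom : ∀ d b κ w → run (archStep d b κ) w ≡ ground → ArchExit d b ((κ , b) ∷ w)

archExit d b [] ()
archExit d true  ((κ , true)  ∷ w) h = archExitFrom d true κ w h
archExit d false ((κ , false) ∷ w) h = archExitFrom d false κ w h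
archExit d true  ((κ , false) ∷ w) h with trans (sym h) (run-dead w)
... | ()
archExit d false ((κ , true)  ∷ w) h with trans (sym h) (run-dead w)
... | ()

-- The arch closes at a closer at depth 0 (the minimum was a singleton) or at an
-- inner element at depth 0 (the minimum was an opener); otherwise keep reading.
archExitFrom zero b closer w h = record
  { inside = [] ; kind = singleton ; outside = w ; minKind = singleton ; split = refl
  ; insideUnflipped = [] ; insideRun = refl ; outsideBalanced = h }
archExitFrom zero b inner w h = record
  { inside = [] ; kind = opener ; outside = w ; minKind = opener ; split = refl
  ; insideUnflipped = [] ; insideRun = refl ; outsideBalanced = h }
archExitFrom d b opener w h = extendExit (deeper d) (archExit (suc d) b w h)
  where deeper : ∀ d → step (unnest d) (opener , false) ≡ unnest (suc d)
        deeper zero    = refl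
        deeper (suc d) = refl
archExitFrom (suc d) b closer w h = extendExit (shallower d) (archExit d b w h)
  where shallower : ∀ d → step (unnest (suc d)) (closer , false) ≡ unnest d
        shallower zero    = refl
        shallower (suc d) = refl
archExitFrom d b singleton w h = extendExit (level d) (archExit d b w h)
  where level : ∀ d → step (unnest d) (singleton , false) ≡ unnest d
        level zero    = refl
        level (suc d) = refl
archExitFrom (suc d) b inner w h = extendExit refl (archExit (suc d) b w h)

T-implication⇒ : ∀ a b → T (not a ∨ b) → T a → T b
T-implication⇒ true b t _ = t

T-implication⇐ : ∀ a b → (T a → T b) → T (not a ∨ b)
T-implication⇐ false b f = tt
T-implication⇐ true  b f = f tt

T-ext : ∀ {a b} → (T a → T b) → (T b → T a) → a ≡ b
T-ext {false} {false} _ _ = refl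
T-ext {false} {true}  _ g = ⊥-elim (g tt)
T-ext {true}  {false} f _ = ⊥-elim (f tt)
T-ext {true}  {true}  _ _ = refl

T-false : ∀ {a} → ¬ T a → a ≡ false
T-false {false} _ = refl
T-false {true}  n = ⊥-elim (n tt)

T-true : ∀ {a} → T a → a ≡ true
T-true {true} _ = refl

false-¬T : ∀ {a} → a ≡ false → ¬ T a
false-¬T refl ()

true-T : ∀ {a} → a ≡ true → T a
true-T refl = tt

∧-split : ∀ a {b} → T (a ∧ b) → T a × T b
∧-split true t = tt , t

∧-join : ∀ a {b} → T a → T b → T (a ∧ b)
∧-join true _ t = t

all-allFin⇒ : ∀ {n} (p : Fin n → Bool) → T (all p (allFin n)) → ∀ i → T (p i)
all-allFin⇒ {n} p t = Allₚ.tabulate⁻ (Allₚ.all⁺ p (allFin n) t)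

all-allFin⇐ : ∀ {n} (p : Fin n → Bool) → (∀ i → T (p i)) → T (all p (allFin n))
all-allFin⇐ p f = Allₚ.all⁻ p (Allₚ.tabulate⁺ f)

any-allFin⇒ : ∀ {n} (p : Fin n → Bool) → T (any p (allFin n)) → ∃ λ i → T (p i)
any-allFin⇒ {n} p t = Anyₚ.tabulate⁻ (Anyₚ.any⁻ p (allFin n) t)

any-allFin⇐ : ∀ {n} (p : Fin n → Bool) i → T (p i) → T (any p (allFin n))
any-allFin⇐ p i t = Anyₚ.any⁺ p (Anyₚ.tabulate⁺ i t)

leᵇ⇒ : ∀ {n} (i j : Fin n) → T (leᵇ i j) → toℕ i ≤ toℕ j
leᵇ⇒ i j = ℕP.≤ᵇ⇒≤ (toℕ i) (toℕ j)

leᵇ⇐ : ∀ {n} (i j : Fin n) → toℕ i ≤ toℕ j → T (leᵇ i j)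
leᵇ⇐ i j = ℕP.≤⇒≤ᵇ

isMinᵇ⇒ : ∀ {n} (R : Rel n) i → T (isMinᵇ R i) → IsMinOfBlock R i
isMinᵇ⇒ R i t k r = leᵇ⇒ i k (T-implication⇒ (R i k) _ (all-allFin⇒ _ t k) r)

isMinᵇ⇐ : ∀ {n} (R : Rel n) i → IsMinOfBlock R i → T (isMinᵇ R i)
isMinᵇ⇐ R i f = all-allFin⇐ _ (λ k → T-implication⇐ (R i k) _ (λ r → leᵇ⇐ i k (f k r)))

isMaxᵇ⇒ : ∀ {n} (R : Rel n) i → T (isMaxᵇ R i) → IsMaxOfBlock R i
isMaxᵇ⇒ R i t k r = leᵇ⇒ k i (T-implication⇒ (R i k) _ (all-allFin⇒ _ t k) r)

isMaxᵇ⇐ : ∀ {n} (R : Rel n) i → IsMaxOfBlock R i → T (isMaxᵇ R i)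
isMaxᵇ⇐ R i f = all-allFin⇐ _ (λ k → T-implication⇐ (R i k) _ (λ r → leᵇ⇐ k i (f k r)))

Covers : ∀ {n} → Rel n → (Fin n → Bool) → Fin n → Fin n → Set
Covers R X m i = T (X m) × (toℕ m ≤ toℕ i) × (∃ λ l → T (R m l) × toℕ i ≤ toℕ l)

covers⇒ : ∀ {n} (R : Rel n) X m i → T (covers R X m i) → Covers R X m i
covers⇒ R X m i t with ∧-split (X m) t
... | xm , t′ with ∧-split (leᵇ m i) t′
... | m≤i , t″ with any-allFin⇒ (λ k → R m k ∧ leᵇ i k) t″
... | l , q with ∧-split (R m l) q
... | r , i≤l = xm , leᵇ⇒ m i m≤i , l , r , leᵇ⇒ i l i≤l

covers⇐ : ∀ {n} (R : Rel n) X m i → Covers R X m i → T (covers R X m i)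
covers⇐ R X m i (xm , m≤i , l , r , i≤l) =
  ∧-join (X m) xm (∧-join (leᵇ m i) (leᵇ⇐ m i m≤i)
    (any-allFin⇐ (λ k → R m k ∧ leᵇ i k) l (∧-join (R m l) r (leᵇ⇐ i l i≤l))))

covers-ext : ∀ {n n′} (R : Rel n) X m i (R′ : Rel n′) X′ m′ i′ →
  (Covers R X m i → Covers R′ X′ m′ i′) → (Covers R′ X′ m′ i′ → Covers R X m i) →
  covers R X m i ≡ covers R′ X′ m′ i′
covers-ext R X m i R′ X′ m′ i′ f g =
  T-ext (λ t → covers⇐ R′ X′ m′ i′ (f (covers⇒ R X m i t))) (λ t → covers⇐ R X m i (g (covers⇒ R′ X′ m′ i′ t)))

covers-false : ∀ {n} (R : Rel n) X m i → ¬ Covers R X m i → covers R X m i ≡ false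
covers-false R X m i notCovered = T-false (λ t → notCovered (covers⇒ R X m i t))

parity : ∀ {n} → (Fin n → Bool) → Bool
parity {zero}  c = false
parity {suc n} c = c F.zero xor parity (λ m → c (F.suc m))

flipParity-parity : ∀ {n} (R : Rel n) X i → flipParity R X i ≡ parity (λ m → covers R X m i)
flipParity-parity R X i = foldr-tabulate (λ m → covers R X m i) (λ m → m)
  where
  foldr-tabulate : ∀ {n} {A : Set} (c : A → Bool) (h : Fin n → A) →
    foldr (λ m b → c m xor b) false (tabulate h) ≡ parity (λ m → c (h m))
  foldr-tabulate {zero}  c h = refl
  foldr-tabulate {suc n} c h = cong (c (h F.zero) xor_) (foldr-tabulate c (λ m → h (F.suc m)))

parity-cong : ∀ {n} (c c′ : Fin n → Bool) → (∀ m → c m ≡ c′ m) → parity c ≡ parity c′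
parity-cong {zero}  c c′ e = refl
parity-cong {suc n} c c′ e = cong₂ _xor_ (e F.zero) (parity-cong _ _ (λ m → e (F.suc m)))

parity-false : ∀ {n} (c : Fin n → Bool) → (∀ m → c m ≡ false) → parity c ≡ false
parity-false {zero}  c e = refl
parity-false {suc n} c e rewrite e F.zero = parity-false _ (λ m → e (F.suc m))

parity-change : ∀ {n} k (c c′ : Fin n → Bool) → (∀ m → m ≢ k → c′ m ≡ c m) → c k ≡ false →
  parity c′ ≡ c′ k xor parity c
parity-change F.zero c c′ e ck rewrite ck =
  cong (c′ F.zero xor_) (parity-cong _ _ (λ m → e (F.suc m) (λ ())))
parity-change (F.suc k) c c′ e ck = begin
  c′ F.zero xor parity (λ m → c′ (F.suc m))
    ≡⟨ cong₂ _xor_ (e F.zero (λ ())) (parity-change k _ _ (λ m m≢k → e (F.suc m) (λ eq → m≢k (FP.suc-injective eq))) ck) ⟩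
  c F.zero xor (c′ (F.suc k) xor parity (λ m → c (F.suc m)))
    ≡⟨ xor-swap (c F.zero) (c′ (F.suc k)) _ ⟩
  c′ (F.suc k) xor (c F.zero xor parity (λ m → c (F.suc m))) ∎
  where
  open ≡-Reasoning
  xor-swap : ∀ a b z → a xor (b xor z) ≡ b xor (a xor z)
  xor-swap false b z = refl
  xor-swap true false z = refl
  xor-swap true true z = refl

parity-single : ∀ {n} k (c : Fin n → Bool) → (∀ m → m ≢ k → c m ≡ false) → parity c ≡ c k
parity-single {n} k c e = begin
  parity c                                   ≡⟨ parity-change k (λ _ → false) c e refl ⟩
  c k xor parity {n} (λ _ → false)           ≡⟨ cong (c k xor_) (parity-false {n} _ (λ _ → refl)) ⟩
  c k xor false                              ≡⟨ Boolₚ.xor-identityʳ (c k) ⟩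
  c k                                        ∎
  where open ≡-Reasoning

kindFrom : (isMin isMax : Bool) → Kind
kindFrom true  false = opener
kindFrom false true  = closer
kindFrom true  true  = singleton
kindFrom false false = inner

kindFrom-min : ∀ isMax → IsMinKind (kindFrom true isMax)
kindFrom-min true  = singleton
kindFrom-min false = opener

letter : ∀ {n} → Rel n → (Fin n → Bool) → Fin n → Letter
letter R X i = kindFrom (isMinᵇ R i) (isMaxᵇ R i) , flipParity R X i

word : ∀ {n} → Rel n → (Fin n → Bool) → Word
word R X = tabulate (letter R X)

g-word : ∀ {n} (R : Rel n) X → g R X ≡ wordPath (word R X)
g-word {n} R X = concatMap-tabulate (λ i → i)
  where
  gSteps-letter : ∀ i → gSteps R X i ≡ letterPath (letter R X i)
  gSteps-letter i with isMinᵇ R i | isMaxᵇ R i | flipParity R X i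
  ... | true  | false | false = refl
  ... | false | true  | false = refl
  ... | true  | true  | false = refl
  ... | false | false | false = refl
  ... | true  | false | true  = refl
  ... | false | true  | true  = refl
  ... | true  | true  | true  = refl
  ... | false | false | true  = refl
  concatMap-tabulate : ∀ {m} (h : Fin m → Fin n) →
    concatMap (gSteps R X) (tabulate h) ≡ wordPath (tabulate (λ j → letter R X (h j)))
  concatMap-tabulate {zero}  h = refl
  concatMap-tabulate {suc m} h = cong₂ _++_ (gSteps-letter (h F.zero)) (concatMap-tabulate (λ j → h (F.suc j)))

tabulate-split : ∀ {n} {A : Set} (k : Fin n) (e : Fin n → A) →
  tabulate e ≡ take (toℕ k) (tabulate e) ++ e k ∷ drop (suc (toℕ k)) (tabulate e)
tabulate-split F.zero    e = refl
tabulate-split (F.suc k) e = cong (e F.zero ∷_) (tabulate-split k (λ i → e (F.suc i)))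

length-take-tabulate : ∀ {n} {A : Set} (k : Fin n) (e : Fin n → A) → length (take (toℕ k) (tabulate e)) ≡ toℕ k
length-take-tabulate F.zero    e = refl
length-take-tabulate (F.suc k) e = cong suc (length-take-tabulate k (λ i → e (F.suc i)))

All-take-tabulate⇒ : ∀ {n} {A : Set} {P : A → Set} (e : Fin n → A) m →
  All P (take m (tabulate e)) → ∀ i → toℕ i < m → P (e i)
All-take-tabulate⇒ e (suc m) (p ∷ _)  F.zero    _        = p
All-take-tabulate⇒ e (suc m) (_ ∷ ps) (F.suc i) (s≤s lt) = All-take-tabulate⇒ (λ j → e (F.suc j)) m ps i lt

All-take-tabulate⇐ : ∀ {n} {A : Set} {P : A → Set} (e : Fin n → A) m →
  (∀ i → toℕ i < m → P (e i)) → All P (take m (tabulate e))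
All-take-tabulate⇐ {zero}  e m       f = Allₚ.take⁺ m []
All-take-tabulate⇐ {suc n} e zero    f = []
All-take-tabulate⇐ {suc n} e (suc m) f =
  f F.zero (s≤s z≤n) ∷ All-take-tabulate⇐ (λ j → e (F.suc j)) m (λ i lt → f (F.suc i) (s≤s lt))

-- The letters after joining a new first element to the block with minimum k:
-- the letters before k are flipped by b and the letter at k loses minimality.
joinLetters : ∀ {n} → Fin n → Bool → (Fin n → Letter) → Fin n → Letter
joinLetters F.zero    b e F.zero    = loseMin (e F.zero)
joinLetters F.zero    b e (F.suc i) = e (F.suc i)
joinLetters (F.suc k) b e F.zero    = flipBy b (e F.zero)
joinLetters (F.suc k) b e (F.suc i) = joinLetters k b (λ j → e (F.suc j)) i

joinLetters-< : ∀ {n} (k : Fin n) b e i → toℕ i < toℕ k → joinLetters k b e i ≡ flipBy b (e i)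
joinLetters-< (F.suc k) b e F.zero    _        = refl
joinLetters-< (F.suc k) b e (F.suc i) (s≤s lt) = joinLetters-< k b _ i lt

joinLetters-≡ : ∀ {n} (k : Fin n) b e → joinLetters k b e k ≡ loseMin (e k)
joinLetters-≡ F.zero    b e = refl
joinLetters-≡ (F.suc k) b e = joinLetters-≡ k b _

joinLetters-> : ∀ {n} (k : Fin n) b e i → toℕ k < toℕ i → joinLetters k b e i ≡ e i
joinLetters-> F.zero    b e (F.suc i) _        = refl
joinLetters-> (F.suc k) b e (F.suc i) (s≤s lt) = joinLetters-> k b _ i lt

tabulate-joinLetters : ∀ {n} (k : Fin n) b e →
  tabulate (joinLetters k b e)
    ≡ map (flipBy b) (take (toℕ k) (tabulate e)) ++ loseMin (e k) ∷ drop (suc (toℕ k)) (tabulate e)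
tabulate-joinLetters F.zero    b e = refl
tabulate-joinLetters (F.suc k) b e = cong (flipBy b (e F.zero) ∷_) (tabulate-joinLetters k b (λ j → e (F.suc j)))

-- The letters of a partition of [n+1] are computed from those of its last n
-- elements; restrict R is R on these elements, renumbered.
restrict : ∀ {n} → Rel (suc n) → Rel n
restrict R i j = R (F.suc i) (F.suc j)

isMaxᵇ-suc : ∀ {n} (R : Rel (suc n)) i → isMaxᵇ R (F.suc i) ≡ isMaxᵇ (restrict R) i
isMaxᵇ-suc R i = T-ext
  (λ t → isMaxᵇ⇐ (restrict R) i (λ l r → ℕP.≤-pred (isMaxᵇ⇒ R (F.suc i) t (F.suc l) r)))
  (λ t → isMaxᵇ⇐ R (F.suc i) (λ { F.zero _ → z≤n ; (F.suc l) r → s≤s (isMaxᵇ⇒ (restrict R) i t l r) }))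

isMinᵇ-suc : ∀ {n} (R : Rel (suc n)) i → (IsMinOfBlock (restrict R) i → ¬ T (R (F.suc i) F.zero)) →
  isMinᵇ R (F.suc i) ≡ isMinᵇ (restrict R) i
isMinᵇ-suc R i notJoined = T-ext
  (λ t → isMinᵇ⇐ (restrict R) i (λ l r → ℕP.≤-pred (isMinᵇ⇒ R (F.suc i) t (F.suc l) r)))
  (λ t → isMinᵇ⇐ R (F.suc i) (λ { F.zero r → ⊥-elim (notJoined (isMinᵇ⇒ (restrict R) i t) r)
                                 ; (F.suc l) r → s≤s (isMinᵇ⇒ (restrict R) i t l r) }))

covers-suc : ∀ {n} (R : Rel (suc n)) X X′ m i → X (F.suc m) ≡ X′ m →
  covers R X (F.suc m) (F.suc i) ≡ covers (restrict R) X′ m i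
covers-suc R X X′ m i xm = covers-ext R X (F.suc m) (F.suc i) (restrict R) X′ m i
  (λ { (x , _ , F.zero , _ , ())
     ; (x , m≤i , F.suc l , r , i≤l) → subst T xm x , ℕP.≤-pred m≤i , l , r , ℕP.≤-pred i≤l })
  (λ (x , m≤i , l , r , i≤l) → subst T (sym xm) x , s≤s m≤i , F.suc l , r , s≤s i≤l)

flipParity-first : ∀ {n} (R : Rel n) X k → T (R k k) → (∀ m → toℕ m < toℕ k → X m ≡ false) →
  flipParity R X k ≡ X k
flipParity-first R X k Rkk unmarked = begin
  flipParity R X k                    ≡⟨ flipParity-parity R X k ⟩
  parity (λ m → covers R X m k)       ≡⟨ parity-single k _ others ⟩
  covers R X k k                      ≡⟨ T-ext (λ t → proj₁ (covers⇒ R X k k t))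
                                               (λ t → covers⇐ R X k k (t , ℕP.≤-refl , k , Rkk , ℕP.≤-refl)) ⟩
  X k                                 ∎
  where
  open ≡-Reasoning
  others : ∀ m → m ≢ k → covers R X m k ≡ false
  others m m≢k = covers-false R X m k (λ (x , m≤k , _) →
    false-¬T (unmarked m (ℕP.≤∧≢⇒< m≤k (λ eq → m≢k (FP.toℕ-injective eq)))) x)

flipParity-unmarked : ∀ {n} (R : Rel n) X p → (∀ m → toℕ m < p → X m ≡ false) →
  ∀ i → toℕ i < p → flipParity R X i ≡ false
flipParity-unmarked R X p unmarked i i<p = trans (flipParity-parity R X i) (parity-false _ notCovered)
  where
  notCovered : ∀ m → covers R X m i ≡ false
  notCovered m = covers-false R X m i (λ (x , m≤i , _) → false-¬T (unmarked m (ℕP.≤-<-trans m≤i i<p)) x)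

record SingletonFirst {n} (R : Rel (suc n)) : Set where
  field
    self   : R F.zero F.zero ≡ true
    alone  : ∀ j → R F.zero (F.suc j) ≡ false
    alone′ : ∀ i → R (F.suc i) F.zero ≡ false

record JoinedFirst {n} (R : Rel (suc n)) (k : Fin n) : Set where
  field
    self    : R F.zero F.zero ≡ true
    joins   : ∀ j → R F.zero (F.suc j) ≡ restrict R k j
    joins′  : ∀ i → R (F.suc i) F.zero ≡ restrict R i k
    kIsMin  : IsMinOfBlock (restrict R) k

-- The marks of a partition whose first element joins the block of k: the
-- mark of that block moves to the first element.
record MovedMarks {n} (X : Fin (suc n) → Bool) (X′ : Fin n → Bool) (k : Fin n) : Set where
  field
    moved   : X F.zero ≡ X′ k
    cleared : X (F.suc k) ≡ false
    kept    : ∀ m → m ≢ k → X (F.suc m) ≡ X′ m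

letter-first : ∀ {n} (R : Rel (suc n)) X → R F.zero F.zero ≡ true →
  letter R X F.zero ≡ (kindFrom true (isMaxᵇ R F.zero) , X F.zero)
letter-first R X self =
  cong₂ _,_ (cong (λ b → kindFrom b (isMaxᵇ R F.zero)) (T-true (isMinᵇ⇐ R F.zero (λ _ _ → z≤n))))
            (flipParity-first R X F.zero (true-T self) (λ _ ()))

letter-singletonFirst : ∀ {n} (R : Rel (suc n)) X → SingletonFirst R →
  ∀ i → letter R X (F.suc i) ≡ letter (restrict R) (λ m → X (F.suc m)) i
letter-singletonFirst R X S i =
  cong₂ _,_ (cong₂ kindFrom (isMinᵇ-suc R i (λ _ r → false-¬T (alone′ i) r)) (isMaxᵇ-suc R i)) flip
  where
  open SingletonFirst S
  X′ : Fin _ → Bool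
  X′ m = X (F.suc m)
  flip : flipParity R X (F.suc i) ≡ flipParity (restrict R) X′ i
  flip = begin
    flipParity R X (F.suc i)
      ≡⟨ flipParity-parity R X (F.suc i) ⟩
    covers R X F.zero (F.suc i) xor parity (λ m → covers R X (F.suc m) (F.suc i))
      ≡⟨ cong₂ _xor_ (covers-false R X F.zero (F.suc i) firstAlone)
                     (parity-cong _ (λ m → covers (restrict R) X′ m i) (λ m → covers-suc R X X′ m i refl)) ⟩
    parity (λ m → covers (restrict R) X′ m i)
      ≡⟨ sym (flipParity-parity (restrict R) X′ i) ⟩
    flipParity (restrict R) X′ i ∎
    where
    open ≡-Reasoning
    firstAlone : ¬ Covers R X F.zero (F.suc i)
    firstAlone (_ , _ , F.zero  , _ , ())
    firstAlone (_ , _ , F.suc l , r , _) = false-¬T (alone l) r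

word-singletonFirst : ∀ {n} (R : Rel (suc n)) X → SingletonFirst R →
  word R X ≡ (singleton , X F.zero) ∷ word (restrict R) (λ m → X (F.suc m))
word-singletonFirst R X S = cong₂ _∷_ first (LP.tabulate-cong (letter-singletonFirst R X S))
  where
  open SingletonFirst S
  isMax0 : isMaxᵇ R F.zero ≡ true
  isMax0 = T-true (isMaxᵇ⇐ R F.zero (λ { F.zero _ → z≤n ; (F.suc l) r → ⊥-elim (false-¬T (alone l) r) }))
  first : letter R X F.zero ≡ (singleton , X F.zero)
  first = trans (letter-first R X self) (cong (λ b → (kindFrom true b , X F.zero)) isMax0)

module JoinedFirstWord {n} (R : Rel (suc n)) (X : Fin (suc n) → Bool) (X′ : Fin n → Bool) (k : Fin n)
         (eqv : IsEquivalence (restrict R)) (J : JoinedFirst R k) (M : MovedMarks X X′ k) where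

  open JoinedFirst J
  open MovedMarks M

  R′ : Rel n
  R′ = restrict R

  joined : T (R F.zero (F.suc k))
  joined = subst T (sym (joins k)) (proj₁ eqv k)

  first : letter R X F.zero ≡ (opener , X′ k)
  first = trans (letter-first R X self) (cong₂ (λ b c → (kindFrom true b , c)) notMax moved)
    where notMax : isMaxᵇ R F.zero ≡ false
          notMax = T-false (λ t → case isMaxᵇ⇒ R F.zero t (F.suc k) joined of λ ())

  kNotMin : isMinᵇ R (F.suc k) ≡ false
  kNotMin = T-false (λ t → case isMinᵇ⇒ R (F.suc k) t F.zero (subst T (sym (joins′ k)) (proj₁ eqv k)) of λ ())

  otherMin : ∀ i → i ≢ k → isMinᵇ R (F.suc i) ≡ isMinᵇ R′ i
  otherMin i i≢k = isMinᵇ-suc R i (λ iMin r →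
    let Rik = subst T (joins′ i) r in
    i≢k (FP.toℕ-injective (ℕP.≤-antisym (iMin k Rik) (kIsMin i (proj₁ (proj₂ eqv) i k Rik)))))

  covers-rest : ∀ i →
    parity (λ m → covers R′ X′ m i) ≡ covers R′ X′ k i xor parity (λ m → covers R X (F.suc m) (F.suc i))
  covers-rest i = parity-change k _ _ (λ m m≢k → sym (covers-suc R X X′ m i (kept m m≢k)))
                    (covers-false R X (F.suc k) (F.suc i) (λ c → false-¬T cleared (proj₁ c)))

  flip-≥ : ∀ i → toℕ k ≤ toℕ i → flipParity R X (F.suc i) ≡ flipParity R′ X′ i
  flip-≥ i k≤i = begin
    flipParity R X (F.suc i)
      ≡⟨ flipParity-parity R X (F.suc i) ⟩
    covers R X F.zero (F.suc i) xor parity (λ m → covers R X (F.suc m) (F.suc i))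
      ≡⟨ cong (_xor parity (λ m → covers R X (F.suc m) (F.suc i))) sameBlock ⟩
    covers R′ X′ k i xor parity (λ m → covers R X (F.suc m) (F.suc i))
      ≡⟨ sym (covers-rest i) ⟩
    parity (λ m → covers R′ X′ m i)
      ≡⟨ sym (flipParity-parity R′ X′ i) ⟩
    flipParity R′ X′ i ∎
    where
    open ≡-Reasoning
    sameBlock : covers R X F.zero (F.suc i) ≡ covers R′ X′ k i
    sameBlock = covers-ext R X F.zero (F.suc i) R′ X′ k i
      (λ { (_ , _ , F.zero , _ , ())
         ; (x , _ , F.suc l , r , i≤l) → subst T moved x , k≤i , l , subst T (joins l) r , ℕP.≤-pred i≤l })
      (λ (x , _ , l , r , i≤l) → subst T (sym moved) x , z≤n , F.suc l , subst T (sym (joins l)) r , s≤s i≤l)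

  flip-< : ∀ i → toℕ i < toℕ k → flipParity R X (F.suc i) ≡ flipParity R′ X′ i xor X′ k
  flip-< i i<k = begin
    flipParity R X (F.suc i)
      ≡⟨ flipParity-parity R X (F.suc i) ⟩
    covers R X F.zero (F.suc i) xor parity (λ m → covers R X (F.suc m) (F.suc i))
      ≡⟨ cong (_xor parity (λ m → covers R X (F.suc m) (F.suc i))) underArch ⟩
    X′ k xor parity (λ m → covers R X (F.suc m) (F.suc i))
      ≡⟨ Boolₚ.xor-comm (X′ k) _ ⟩
    parity (λ m → covers R X (F.suc m) (F.suc i)) xor X′ k
      ≡⟨ cong (_xor X′ k) (sym (trans (covers-rest i) (cong (_xor _) kAfter))) ⟩
    parity (λ m → covers R′ X′ m i) xor X′ k
      ≡⟨ cong (_xor X′ k) (sym (flipParity-parity R′ X′ i)) ⟩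
    flipParity R′ X′ i xor X′ k ∎
    where
    open ≡-Reasoning
    underArch : covers R X F.zero (F.suc i) ≡ X′ k
    underArch = T-ext (λ t → subst T moved (proj₁ (covers⇒ R X F.zero (F.suc i) t)))
      (λ t → covers⇐ R X F.zero (F.suc i) (subst T (sym moved) t , z≤n , F.suc k , joined , s≤s (ℕP.<⇒≤ i<k)))
    kAfter : covers R′ X′ k i ≡ false
    kAfter = covers-false R′ X′ k i (λ c → ℕP.<⇒≱ i<k (proj₁ (proj₂ c)))

  later : ∀ i → letter R X (F.suc i) ≡ joinLetters k (X′ k) (letter R′ X′) i
  later i with ℕP.<-cmp (toℕ i) (toℕ k)
  ... | tri< i<k _ _ = trans (cong₂ _,_ (cong₂ kindFrom (otherMin i (λ eq → ℕP.<-irrefl (cong toℕ eq) i<k)) (isMaxᵇ-suc R i))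
                                         (flip-< i i<k))
                             (sym (joinLetters-< k (X′ k) (letter R′ X′) i i<k))
  ... | tri> _ _ k<i = trans (cong₂ _,_ (cong₂ kindFrom (otherMin i (λ eq → ℕP.<-irrefl (cong toℕ (sym eq)) k<i)) (isMaxᵇ-suc R i))
                                         (flip-≥ i (ℕP.<⇒≤ k<i)))
                             (sym (joinLetters-> k (X′ k) (letter R′ X′) i k<i))
  ... | tri≈ _ i≡k _ with FP.toℕ-injective i≡k
  ... | refl = trans (cong₂ _,_ (cong₂ kindFrom kNotMin (isMaxᵇ-suc R k)) (flip-≥ k ℕP.≤-refl))
                     (trans (losesMin (isMaxᵇ R′ k) (T-true (isMinᵇ⇐ R′ k kIsMin)))
                            (sym (joinLetters-≡ k (X′ k) (letter R′ X′))))
    where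
    losesMin : ∀ mx {mn} → mn ≡ true →
      (kindFrom false mx , flipParity R′ X′ k) ≡ loseMin (kindFrom mn mx , flipParity R′ X′ k)
    losesMin true  refl = refl
    losesMin false refl = refl

  word-joinedFirst :
    word R X ≡ joinWord (X′ k) (take (toℕ k) (word R′ X′)) (letter R′ X′ k) (drop (suc (toℕ k)) (word R′ X′))
  word-joinedFirst = cong₂ _∷_ first (trans (LP.tabulate-cong later) (tabulate-joinLetters k (X′ k) (letter R′ X′)))

leastSuch : ∀ {n} (P : Fin n → Bool) →
  (∃ λ y → T (P y) × (∀ z → toℕ z < toℕ y → ¬ T (P z))) ⊎ (∀ y → ¬ T (P y))
leastSuch {zero}  P = inj₂ (λ ())
leastSuch {suc n} P with P F.zero in eq
... | true = inj₁ (F.zero , subst T (sym eq) tt , λ z ())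
... | false with leastSuch (λ x → P (F.suc x))
...   | inj₁ (y , t , below) = inj₁ (F.suc y , t , λ { F.zero _ → false-¬T eq ; (F.suc z) (s≤s lt) → below z lt })
...   | inj₂ none = inj₂ (λ { F.zero → false-¬T eq ; (F.suc y) → none y })

least : ∀ {n} (P : Fin n → Bool) x → T (P x) → ∃ λ y → T (P y) × (∀ z → toℕ z < toℕ y → ¬ T (P z))
least P x t with leastSuch P
... | inj₁ r    = r
... | inj₂ none = ⊥-elim (none x t)

greatestSuch : ∀ {n} (P : Fin n → Bool) →
  (∃ λ y → T (P y) × (∀ z → toℕ y < toℕ z → ¬ T (P z))) ⊎ (∀ y → ¬ T (P y))
greatestSuch {zero}  P = inj₂ (λ ())
greatestSuch {suc n} P with greatestSuch (λ x → P (F.suc x))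
... | inj₁ (y , t , above) = inj₁ (F.suc y , t , λ { F.zero () ; (F.suc z) (s≤s lt) → above z lt })
... | inj₂ none with P F.zero in eq
...   | true  = inj₁ (F.zero , subst T (sym eq) tt , λ { F.zero () ; (F.suc z) _ → none z })
...   | false = inj₂ (λ { F.zero → false-¬T eq ; (F.suc y) → none y })

greatest : ∀ {n} (P : Fin n → Bool) x → T (P x) → ∃ λ y → T (P y) × (∀ z → toℕ y < toℕ z → ¬ T (P z))
greatest P x t with greatestSuch P
... | inj₁ r    = r
... | inj₂ none = ⊥-elim (none x t)

module Blocks {n} (R : Rel n) (eqv : IsEquivalence R) where

  R-refl : ∀ i → T (R i i)
  R-refl = proj₁ eqv

  R-sym : ∀ i j → T (R i j) → T (R j i)
  R-sym = proj₁ (proj₂ eqv)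

  R-trans : ∀ i j k → T (R i j) → T (R j k) → T (R i k)
  R-trans = proj₂ (proj₂ eqv)

  sameRow : ∀ i k → T (R i k) → ∀ j → R i j ≡ R k j
  sameRow i k r j = T-ext (R-trans k i j (R-sym i k r)) (R-trans i k j r)

  sameColumn : ∀ i j k → T (R j k) → R i j ≡ R i k
  sameColumn i j k r = T-ext (λ t → R-trans i j k t r) (λ t → R-trans i k j t (R-sym j k r))

  edgeOver : ∀ a b x → T (R a b) → toℕ a < toℕ x → toℕ x < toℕ b → ¬ T (R a x) →
    ∃ λ a′ → ∃ λ b′ → Edge R a′ b′ × (toℕ a′ < toℕ x) × (toℕ x < toℕ b′) × T (R a a′)
  edgeOver a b x Rab a<x x<b ¬Rax
    with greatest (λ y → R a y ∧ (toℕ y <ᵇ toℕ x)) a (∧-join (R a a) (R-refl a) (ℕP.<⇒<ᵇ a<x))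
       | least (λ y → R a y ∧ (toℕ x <ᵇ toℕ y)) b (∧-join (R a b) Rab (ℕP.<⇒<ᵇ x<b))
  ... | a′ , ta′ , maxBelow | b′ , tb′ , minAbove =
    a′ , b′ , (ℕP.<-trans a′<x x<b′ , R-trans a′ a b′ (R-sym a a′ Raa′) Rab′ , between) , a′<x , x<b′ , Raa′
    where
    Raa′ : T (R a a′)
    Raa′ = proj₁ (∧-split (R a a′) ta′)
    Rab′ : T (R a b′)
    Rab′ = proj₁ (∧-split (R a b′) tb′)
    a′<x : toℕ a′ < toℕ x
    a′<x = ℕP.<ᵇ⇒< (toℕ a′) (toℕ x) (proj₂ (∧-split (R a a′) ta′))
    x<b′ : toℕ x < toℕ b′
    x<b′ = ℕP.<ᵇ⇒< (toℕ x) (toℕ b′) (proj₂ (∧-split (R a b′) tb′))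
    between : ∀ l → toℕ a′ < toℕ l → toℕ l < toℕ b′ → ¬ T (R a′ l)
    between l a′<l l<b′ r with ℕP.<-cmp (toℕ l) (toℕ x)
    ... | tri< l<x _ _ = maxBelow l a′<l (∧-join (R a l) (R-trans a a′ l Raa′ r) (ℕP.<⇒<ᵇ l<x))
    ... | tri≈ _ l≡x _ = ¬Rax (subst (λ z → T (R a z)) (FP.toℕ-injective l≡x) (R-trans a a′ l Raa′ r))
    ... | tri> _ _ x<l = minAbove l l<b′ (∧-join (R a l) (R-trans a a′ l Raa′ r) (ℕP.<⇒<ᵇ x<l))

Cut : ∀ {n} → Rel n → ℕ → Set
Cut {n} R p = ∀ i j → toℕ i < p → p ≤ toℕ j → R i j ≡ false

edge-suc⇒ : ∀ {n} (R : Rel (suc n)) i j → Edge (restrict R) i j → Edge R (F.suc i) (F.suc j)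
edge-suc⇒ R i j (i<j , r , between) = s≤s i<j , r , λ { F.zero () _ ; (F.suc l) (s≤s p) (s≤s q) → between l p q }

edge-suc⇐ : ∀ {n} (R : Rel (suc n)) i j → Edge R (F.suc i) (F.suc j) → Edge (restrict R) i j
edge-suc⇐ R i j (s≤s i<j , r , between) = i<j , r , λ l p q → between (F.suc l) (s≤s p) (s≤s q)

restrict-equivalence : ∀ {n} (R : Rel (suc n)) → IsEquivalence R → IsEquivalence (restrict R)
restrict-equivalence R (r , s , t) =
  (λ i → r (F.suc i)) , (λ i j → s (F.suc i) (F.suc j)) , (λ i j k → t (F.suc i) (F.suc j) (F.suc k))

restrict-noncrossing : ∀ {n} (R : Rel (suc n)) → NonCrossing R → NonCrossing (restrict R)
restrict-noncrossing R nc a b c d e e′ a<c c<b b<d =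
  nc _ _ _ _ (edge-suc⇒ R a b e) (edge-suc⇒ R c d e′) (s≤s a<c) (s≤s c<b) (s≤s b<d)

restrict-mark : ∀ {n} (R : Rel (suc n)) m → IsMinOfBlock R (F.suc m) × NonNestedBlock R (F.suc m) →
  IsMinOfBlock (restrict R) m × NonNestedBlock (restrict R) m
restrict-mark R m (isMin , nonNested) =
  (λ l r → ℕP.≤-pred (isMin (F.suc l) r)) ,
  (λ i j M e r isMax i<m M<j → nonNested (F.suc i) (F.suc j) (F.suc M) (edge-suc⇒ R i j e) r
     (λ { F.zero _ → z≤n ; (F.suc l) r′ → s≤s (isMax l r′) }) (s≤s i<m) (s≤s M<j))

restrict-valid : ∀ {n} (R : Rel (suc n)) X → ValidNCNN R X → ValidNCNN (restrict R) (λ m → X (F.suc m))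
restrict-valid R X (eqv , nc , marks) =
  restrict-equivalence R eqv , restrict-noncrossing R nc , λ m t → restrict-mark R m (marks (F.suc m) t)

moveMark : ∀ {n} → (Fin (suc n) → Bool) → Fin n → Fin n → Bool
moveMark X k m with m FP.≟ k
... | yes _ = X F.zero
... | no  _ = X (F.suc m)

moveMark-k : ∀ {n} X (k : Fin n) → moveMark X k k ≡ X F.zero
moveMark-k X k with k FP.≟ k
... | yes _  = refl
... | no k≢k = ⊥-elim (k≢k refl)

moveMark-other : ∀ {n} X (k m : Fin n) → m ≢ k → moveMark X k m ≡ X (F.suc m)
moveMark-other X k m m≢k with m FP.≟ k
... | yes m≡k = ⊥-elim (m≢k m≡k)
... | no  _   = refl

-- In a noncrossing partition whose first element is followed in its block
-- next by k+1, the elements 1,…,k are a union of unmarked blocks, and the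
-- rest is again a noncrossing partition with the first element's mark moved to k.
module FirstEdge {n} (R : Rel (suc n)) (X : Fin (suc n) → Bool) (valid : ValidNCNN R X) (k : Fin n)
                 (joined : T (R F.zero (F.suc k))) (first : ∀ z → toℕ z < toℕ k → ¬ T (R F.zero (F.suc z))) where

  private
    eqv : IsEquivalence R
    eqv = proj₁ valid
    nc : NonCrossing R
    nc = proj₁ (proj₂ valid)
    marksOK : ∀ m → T (X m) → IsMinOfBlock R m × NonNestedBlock R m
    marksOK = proj₂ (proj₂ valid)
  open Blocks R eqv

  firstEdge : Edge R F.zero (F.suc k)
  firstEdge = s≤s z≤n , joined , λ { F.zero () _ ; (F.suc l) _ (s≤s l<k) → first l l<k }

  private
    notWithK : ∀ i → toℕ i < toℕ k → ¬ T (R (F.suc i) (F.suc k))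
    notWithK i i<k r = first i i<k (R-trans F.zero (F.suc k) (F.suc i) joined (R-sym _ _ r))

  -- A block linking 1,…,k with a later element would have an edge crossing (0, k+1).
  cut : Cut (restrict R) (toℕ k)
  cut i j i<k k≤j = T-false separate
    where
    separate : ¬ T (R (F.suc i) (F.suc j))
    separate r with ℕP.m≤n⇒m<n∨m≡n k≤j
    ... | inj₂ k≡j = notWithK i i<k (subst (λ z → T (R (F.suc i) (F.suc z))) (sym (FP.toℕ-injective k≡j)) r)
    ... | inj₁ k<j with edgeOver (F.suc i) (F.suc j) (F.suc k) r (s≤s i<k) (s≤s k<j) (notWithK i i<k)
    ...   | F.zero    , _  , _ , _    , _    , Ri0 = first i i<k (R-sym _ _ Ri0)
    ...   | F.suc a′  , b′ , e , a′<k , k<b′ , _   = nc F.zero (F.suc k) (F.suc a′) b′ firstEdge e (s≤s z≤n) a′<k k<b′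

  -- Blocks among 1,…,k are nested under the edge (0, k+1), so they carry no mark.
  unmarkedBefore : ∀ m → toℕ m < toℕ k → X (F.suc m) ≡ false
  unmarkedBefore m m<k = T-false nested
    where
    nested : ¬ T (X (F.suc m))
    nested t with greatest (R (F.suc m)) (F.suc m) (R-refl (F.suc m))
    ... | F.zero , _ , above = above (F.suc m) (s≤s z≤n) (R-refl (F.suc m))
    ... | F.suc M , RmM , above with ℕP.<-cmp (toℕ M) (toℕ k)
    ...   | tri< M<k _ _ = proj₂ (marksOK (F.suc m) t) F.zero (F.suc k) (F.suc M) firstEdge RmM
                             (λ l r → ℕP.≮⇒≥ (λ M<l → above l M<l (R-trans (F.suc m) (F.suc M) l RmM r)))
                             (s≤s z≤n) (s≤s M<k)
    ...   | tri≈ _ M≡k _ = notWithK m m<k (subst (λ z → T (R (F.suc m) (F.suc z))) (FP.toℕ-injective M≡k) RmM)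
    ...   | tri> _ _ k<M = false-¬T (cut m M m<k (ℕP.<⇒≤ k<M)) RmM

  kIsMin : IsMinOfBlock (restrict R) k
  kIsMin l r = ℕP.≮⇒≥ (λ l<k → first l l<k (R-trans F.zero (F.suc k) (F.suc l) joined r))

  shape : JoinedFirst R k
  shape = record
    { self   = T-true (R-refl F.zero)
    ; joins  = λ j → sameRow F.zero (F.suc k) joined (F.suc j)
    ; joins′ = λ i → sameColumn (F.suc i) F.zero (F.suc k) joined
    ; kIsMin = kIsMin }

  marks : MovedMarks X (moveMark X k) k
  marks = record
    { moved   = sym (moveMark-k X k)
    ; cleared = T-false (λ t → case proj₁ (marksOK (F.suc k) t) F.zero (R-sym _ _ joined) of λ ())
    ; kept    = λ m m≢k → sym (moveMark-other X k m m≢k) }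

  -- The block of k in the rest is nonnested, since an edge over it would cross (0, k+1).
  restValid : ValidNCNN (restrict R) (moveMark X k)
  restValid = restrict-equivalence R eqv , restrict-noncrossing R nc , moved
    where
    moved : ∀ m → T (moveMark X k m) → IsMinOfBlock (restrict R) m × NonNestedBlock (restrict R) m
    moved m t with m FP.≟ k
    ... | no  _    = restrict-mark R m (marksOK (F.suc m) t)
    ... | yes refl = kIsMin , λ i j M e r _ i<k M<j →
          nc F.zero (F.suc k) (F.suc i) (F.suc j) firstEdge (edge-suc⇒ R i j e) (s≤s z≤n) (s≤s i<k)
             (s≤s (ℕP.≤-<-trans (kIsMin M r) M<j))

record SingletonCase {n} (R : Rel (suc n)) (X : Fin (suc n) → Bool) : Set where
  field
    shape     : SingletonFirst R
    restValid : ValidNCNN (restrict R) (λ m → X (F.suc m))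

record JoinCase {n} (R : Rel (suc n)) (X : Fin (suc n) → Bool) : Set where
  field
    k              : Fin n
    shape          : JoinedFirst R k
    cut            : Cut (restrict R) (toℕ k)
    unmarkedBefore : ∀ m → toℕ m < toℕ k → X (F.suc m) ≡ false
    X′             : Fin n → Bool
    marks          : MovedMarks X X′ k
    restValid      : ValidNCNN (restrict R) X′

peel : ∀ {n} (R : Rel (suc n)) X → ValidNCNN R X → SingletonCase R X ⊎ JoinCase R X
peel R X valid with leastSuch (λ j → R F.zero (F.suc j))
... | inj₂ none = inj₁ (record
      { shape = record { self = T-true (R-refl F.zero) ; alone = λ j → T-false (none j)
                       ; alone′ = λ i → T-false (λ t → none i (R-sym _ _ t)) }
      ; restValid = restrict-valid R X valid })
  where open Blocks R (proj₁ valid)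
... | inj₁ (k , joined , first) = inj₂ (record
      { k = k ; shape = shape ; cut = cut ; unmarkedBefore = unmarkedBefore
      ; X′ = moveMark X k ; marks = marks ; restValid = restValid })
  where open FirstEdge R X valid k joined first

module JoinCaseWord {n} {R : Rel (suc n)} {X : Fin (suc n) → Bool} (J : JoinCase R X) where
  open JoinCase J public

  R′ : Rel n
  R′ = restrict R

  w′ : Word
  w′ = word R′ X′

  b : Bool
  b = X′ k

  κ : Kind
  κ = proj₁ (letter R′ X′ k)

  u v : Word
  u = take (toℕ k) w′
  v = drop (suc (toℕ k)) w′

  -- No block of the rest before k is marked, so the letter at k carries X′ k.
  unmarked′ : ∀ m → toℕ m < toℕ k → X′ m ≡ false
  unmarked′ m m<k = trans (sym (MovedMarks.kept marks m (λ m≡k → ℕP.<-irrefl (cong toℕ m≡k) m<k))) (unmarkedBefore m m<k)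

  letter-k : letter R′ X′ k ≡ (κ , b)
  letter-k = cong (κ ,_) (flipParity-first R′ X′ k (proj₁ (proj₁ restValid) k) unmarked′)

  κ-min : IsMinKind κ
  κ-min = subst (λ mn → IsMinKind (kindFrom mn (isMaxᵇ R′ k))) (sym (T-true (isMinᵇ⇐ R′ k (JoinedFirst.kIsMin shape))))
                (kindFrom-min (isMaxᵇ R′ k))

  -- The elements before k, nested under the new arch, were unflipped.
  u-unflipped : Unflipped u
  u-unflipped = All-take-tabulate⇐ (letter R′ X′) (toℕ k) (flipParity-unmarked R′ X′ (toℕ k) unmarked′)

  length-u : length u ≡ toℕ k
  length-u = length-take-tabulate k (letter R′ X′)

  word≡joinWord : word R X ≡ joinWord b u (κ , b) v
  word≡joinWord = trans (JoinedFirstWord.word-joinedFirst R X X′ k (proj₁ restValid) shape marks)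
                        (cong (λ x → joinWord b u x v) letter-k)

  w′≡u++v : w′ ≡ u ++ (κ , b) ∷ v
  w′≡u++v = trans (tabulate-split k (letter R′ X′)) (cong (λ x → u ++ x ∷ v) letter-k)

record PrefixFacts {n} (R : Rel n) (X : Fin n → Bool) : Set where
  field
    cut⇒balanced : ∀ p → p ≤ n → Cut R p → Balanced (take p (word R X))
    balanced⇒cut : ∀ p → Balanced (take p (word R X)) → Cut R p
    marked⇒flipped : ∀ m → T (X m) → flipParity R X m ≡ true

cut-suc : ∀ {n} (R : Rel (suc n)) p → Cut R (suc p) → Cut (restrict R) p
cut-suc R p c i j i<p p≤j = c (F.suc i) (F.suc j) (s≤s i<p) (s≤s p≤j)

-- A singleton first element shifts the ground-level prefixes by one letter.
prefixFacts-singleton : ∀ {n} {R : Rel (suc n)} {X} (S : SingletonCase R X) →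
  PrefixFacts (restrict R) (λ m → X (F.suc m)) → PrefixFacts R X
prefixFacts-singleton {n} {R} {X} S rest =
  record { cut⇒balanced = cut⇒balanced ; balanced⇒cut = balanced⇒cut ; marked⇒flipped = marked⇒flipped }
  where
  open SingletonCase S
  open SingletonFirst shape
  module IH = PrefixFacts rest
  shifted : ∀ p → run ground (take (suc p) (word R X)) ≡ run ground (take p (word (restrict R) (λ m → X (F.suc m))))
  shifted p = cong (λ w → run ground (take (suc p) w)) (word-singletonFirst R X shape)
  cut⇒balanced : ∀ p → p ≤ suc n → Cut R p → Balanced (take p (word R X))
  cut⇒balanced zero    _   _ = refl
  cut⇒balanced (suc p) p≤n c = trans (shifted p) (IH.cut⇒balanced p (ℕP.≤-pred p≤n) (cut-suc R p c))
  balanced⇒cut : ∀ p → Balanced (take p (word R X)) → Cut R p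
  balanced⇒cut (suc p) bal F.zero    (F.suc j) _         _         = alone j
  balanced⇒cut (suc p) bal (F.suc i) (F.suc j) (s≤s i<p) (s≤s p≤j) =
    IH.balanced⇒cut p (trans (sym (shifted p)) bal) i j i<p p≤j
  marked⇒flipped : ∀ m → T (X m) → flipParity R X m ≡ true
  marked⇒flipped F.zero    t = trans (flipParity-first R X F.zero (true-T self) (λ _ ())) (T-true t)
  marked⇒flipped (F.suc m) t = trans (cong proj₂ (letter-singletonFirst R X shape m)) (IH.marked⇒flipped m t)

prefixFacts-join : ∀ {n} {R : Rel (suc n)} {X} (J : JoinCase R X) →
  PrefixFacts (restrict R) (JoinCase.X′ J) → PrefixFacts R X
prefixFacts-join {n} {R} {X} J rest =
  record { cut⇒balanced = cut⇒balanced ; balanced⇒cut = balanced⇒cut ; marked⇒flipped = marked⇒flipped }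
  where
  open JoinCaseWord J
  open JoinedFirst shape
  open MovedMarks marks
  module IH = PrefixFacts rest
  open JoinWord b u κ v (IH.cut⇒balanced (toℕ k) (ℕP.<⇒≤ (FP.toℕ<n k)) cut) u-unflipped κ-min
  k<cut : ∀ p → Cut R (suc p) → length u < p
  k<cut p c = subst (_< p) (sym length-u) (ℕP.≰⇒> (λ p≤k →
    false-¬T (c F.zero (F.suc k) (s≤s z≤n) (s≤s p≤k)) (subst T (sym (joins k)) (proj₁ (proj₁ restValid) k))))
  joinPrefix : ∀ p → run ground (take (suc p) (word R X)) ≡ run ground (take (suc p) (joinWord b u (κ , b) v))
  joinPrefix p = cong (λ w → run ground (take (suc p) w)) word≡joinWord
  restPrefix : ∀ p → run ground (take p w′) ≡ run ground (take p (u ++ (κ , b) ∷ v))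
  restPrefix p = cong (λ w → run ground (take p w)) w′≡u++v
  cut⇒balanced : ∀ p → p ≤ suc n → Cut R p → Balanced (take p (word R X))
  cut⇒balanced zero    _   _ = refl
  cut⇒balanced (suc p) p≤n c = trans (joinPrefix p) (joinWord-prefix⇒ p (k<cut p c)
    (trans (sym (restPrefix p)) (IH.cut⇒balanced p (ℕP.≤-pred p≤n) (cut-suc R p c))))
  balanced⇒cut : ∀ p → Balanced (take p (word R X)) → Cut R p
  balanced⇒cut (suc p) bal = extendCut
    where
    split : (length u < p) × Balanced (take p (u ++ (κ , b) ∷ v))
    split = joinWord-prefix⇐ p (trans (sym (joinPrefix p)) bal)
    restCut : Cut R′ p
    restCut = IH.balanced⇒cut p (trans (restPrefix p) (proj₂ split))
    extendCut : Cut R (suc p)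
    extendCut F.zero    (F.suc j) _         (s≤s p≤j) =
      trans (joins j) (restCut k j (subst (_< p) length-u (proj₁ split)) p≤j)
    extendCut (F.suc i) (F.suc j) (s≤s i<p) (s≤s p≤j) = restCut i j i<p p≤j
  marked⇒flipped : ∀ m → T (X m) → flipParity R X m ≡ true
  marked⇒flipped F.zero    t = trans (flipParity-first R X F.zero (true-T self) (λ _ ())) (T-true t)
  marked⇒flipped (F.suc m) t with ℕP.<-cmp (toℕ k) (toℕ m)
  ... | tri< k<m _ _ = trans (JoinedFirstWord.flip-≥ R X X′ k (proj₁ restValid) shape marks m (ℕP.<⇒≤ k<m))
                             (IH.marked⇒flipped m (subst T (kept m (λ m≡k → ℕP.<-irrefl (cong toℕ (sym m≡k)) k<m)) t))
  ... | tri≈ _ k≡m _ = ⊥-elim (false-¬T (subst (λ z → X (F.suc z) ≡ false) (FP.toℕ-injective k≡m) cleared) t)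
  ... | tri> _ _ m<k = ⊥-elim (false-¬T (unmarkedBefore m m<k) t)

prefixFacts : ∀ n (R : Rel n) X → ValidNCNN R X → PrefixFacts R X
prefixFacts zero R X _ = record
  { cut⇒balanced = λ { zero _ _ → refl }
  ; balanced⇒cut = λ _ _ ()
  ; marked⇒flipped = λ () }
prefixFacts (suc n) R X valid with peel R X valid
... | inj₁ S = prefixFacts-singleton S (prefixFacts n _ _ (SingletonCase.restValid S))
... | inj₂ J = prefixFacts-join J (prefixFacts n _ _ (JoinCase.restValid J))

-- In the join case the word before k is balanced, since k is a cut of the rest.
joinCase-balanced : ∀ {n} {R : Rel (suc n)} {X} (J : JoinCase R X) → Balanced (JoinCaseWord.u J)
joinCase-balanced {n} J = PrefixFacts.cut⇒balanced (prefixFacts n R′ X′ restValid) (toℕ k) (ℕP.<⇒≤ (FP.toℕ<n k)) cut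
  where open JoinCaseWord J

Same : ∀ {n} → Rel n → (Fin n → Bool) → Rel n → (Fin n → Bool) → Set
Same {n} R X R̃ X̃ = (∀ i j → R i j ≡ R̃ i j) × (∀ i → X i ≡ X̃ i)

WordInjective : ℕ → Set
WordInjective n = ∀ (R R̃ : Rel n) X X̃ → ValidNCNN R X → ValidNCNN R̃ X̃ → word R X ≡ word R̃ X̃ → Same R X R̃ X̃

sameSingletonCase : ∀ {n} {R R̃ : Rel (suc n)} {X X̃} → SingletonCase R X → SingletonCase R̃ X̃ →
  WordInjective n → word R X ≡ word R̃ X̃ → Same R X R̃ X̃
sameSingletonCase {R = R} {R̃} {X} {X̃} S S̃ IH eq = sameR , sameX
  where
  module A = SingletonCase S
  module B = SingletonCase S̃
  module SA = SingletonFirst A.shape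
  module SB = SingletonFirst B.shape
  eq′ : (singleton , X F.zero) ∷ word (restrict R) (λ m → X (F.suc m))
      ≡ (singleton , X̃ F.zero) ∷ word (restrict R̃) (λ m → X̃ (F.suc m))
  eq′ = trans (sym (word-singletonFirst R X A.shape)) (trans eq (word-singletonFirst R̃ X̃ B.shape))
  rest : Same (restrict R) (λ m → X (F.suc m)) (restrict R̃) (λ m → X̃ (F.suc m))
  rest = IH (restrict R) (restrict R̃) _ _ A.restValid B.restValid (LP.∷-injectiveʳ eq′)
  sameR : ∀ i j → R i j ≡ R̃ i j
  sameR F.zero    F.zero    = trans SA.self (sym SB.self)
  sameR F.zero    (F.suc j) = trans (SA.alone j) (sym (SB.alone j))
  sameR (F.suc i) F.zero    = trans (SA.alone′ i) (sym (SB.alone′ i))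
  sameR (F.suc i) (F.suc j) = proj₁ rest i j
  sameX : ∀ i → X i ≡ X̃ i
  sameX F.zero    = cong proj₂ (LP.∷-injectiveˡ eq′)
  sameX (F.suc m) = proj₂ rest m

-- Two joined first elements: the join words have equal parts, so the words of
-- the rest agree and the first elements join the same block.
sameJoinCase : ∀ {n} {R R̃ : Rel (suc n)} {X X̃} → (J : JoinCase R X) → (J̃ : JoinCase R̃ X̃) →
  WordInjective n → word R X ≡ word R̃ X̃ → Same R X R̃ X̃
sameJoinCase {R = R} {R̃} {X} {X̃} J J̃ IH eq = sameR , sameX
  where
  module A = JoinCaseWord J
  module B = JoinCaseWord J̃
  module JA = JoinedFirst A.shape
  module JB = JoinedFirst B.shape
  module MA = MovedMarks A.marks
  module MB = MovedMarks B.marks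
  parts : (A.b ≡ B.b) × (A.u ≡ B.u) × (A.κ ≡ B.κ) × (A.v ≡ B.v)
  parts = joinWord-injective (joinCase-balanced J) (joinCase-balanced J̃) A.u-unflipped B.u-unflipped A.κ-min B.κ-min
            (trans (sym A.word≡joinWord) (trans eq B.word≡joinWord))
  b≡ : A.b ≡ B.b
  b≡ = proj₁ parts
  u≡ : A.u ≡ B.u
  u≡ = proj₁ (proj₂ parts)
  κ≡ : A.κ ≡ B.κ
  κ≡ = proj₁ (proj₂ (proj₂ parts))
  v≡ : A.v ≡ B.v
  v≡ = proj₂ (proj₂ (proj₂ parts))
  rest : Same A.R′ A.X′ B.R′ B.X′
  rest = IH A.R′ B.R′ A.X′ B.X′ A.restValid B.restValid
           (trans A.w′≡u++v (trans (cong₂ (λ u x → u ++ x ∷ A.v) u≡ (cong₂ _,_ κ≡ b≡))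
                                   (trans (cong (λ v → B.u ++ (B.κ , B.b) ∷ v) v≡) (sym B.w′≡u++v))))
  k≡ : A.k ≡ B.k
  k≡ = FP.toℕ-injective (trans (sym A.length-u) (trans (cong length u≡) B.length-u))
  sameR : ∀ i j → R i j ≡ R̃ i j
  sameR F.zero    F.zero    = trans JA.self (sym JB.self)
  sameR F.zero    (F.suc j) =
    trans (JA.joins j)  (trans (proj₁ rest A.k j) (trans (cong (λ z → B.R′ z j) k≡) (sym (JB.joins j))))
  sameR (F.suc i) F.zero    =
    trans (JA.joins′ i) (trans (proj₁ rest i A.k) (trans (cong (B.R′ i) k≡) (sym (JB.joins′ i))))
  sameR (F.suc i) (F.suc j) = proj₁ rest i j
  sameX : ∀ i → X i ≡ X̃ i
  sameX F.zero = trans MA.moved (trans (proj₂ rest A.k) (trans (cong B.X′ k≡) (sym MB.moved)))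
  sameX (F.suc m) with m FP.≟ A.k
  ... | yes refl = trans MA.cleared (sym (subst (λ z → X̃ (F.suc z) ≡ false) (sym k≡) MB.cleared))
  ... | no  m≢k  =
    trans (MA.kept m m≢k) (trans (proj₂ rest m) (sym (MB.kept m (λ m≡k → m≢k (trans m≡k (sym k≡))))))

-- The word determines the partition and its marks.  The first letter tells
-- whether the first element is a singleton (singleton letter) or joins a block (opener).
word-injective : ∀ n → WordInjective n
word-injective zero R R̃ X X̃ _ _ _ = (λ ()) , (λ ())
word-injective (suc n) R R̃ X X̃ valid valid~ eq with peel R X valid | peel R̃ X̃ valid~
... | inj₁ S | inj₁ S̃ = sameSingletonCase S S̃ (word-injective n) eq
... | inj₂ J | inj₂ J̃ = sameJoinCase J J̃ (word-injective n) eq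
... | inj₁ S | inj₂ J̃
  with trans (sym (word-singletonFirst R X (SingletonCase.shape S))) (trans eq (JoinCaseWord.word≡joinWord J̃))
...   | ()
word-injective (suc n) R R̃ X X̃ valid valid~ eq | inj₂ J | inj₁ S̃
  with trans (sym (word-singletonFirst R̃ X̃ (SingletonCase.shape S̃))) (trans (sym eq) (JoinCaseWord.word≡joinWord J))
... | ()

singletonR : ∀ {n} → Rel n → Rel (suc n)
singletonR R F.zero    F.zero    = true
singletonR R F.zero    (F.suc j) = false
singletonR R (F.suc i) F.zero    = false
singletonR R (F.suc i) (F.suc j) = R i j

joinR : ∀ {n} → Rel n → Fin n → Rel (suc n)
joinR R k F.zero    F.zero    = true
joinR R k F.zero    (F.suc j) = R k j
joinR R k (F.suc i) F.zero    = R i k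
joinR R k (F.suc i) (F.suc j) = R i j

singletonMarks : ∀ {n} → Bool → (Fin n → Bool) → Fin (suc n) → Bool
singletonMarks f X F.zero    = f
singletonMarks f X (F.suc m) = X m

joinMarks : ∀ {n} → Bool → (Fin n → Bool) → Fin n → Fin (suc n) → Bool
joinMarks f X k F.zero = f
joinMarks f X k (F.suc m) with m FP.≟ k
... | yes _ = false
... | no  _ = X m

joinMarks-movedMarks : ∀ {n} f X (k : Fin n) → X k ≡ f → MovedMarks (joinMarks f X k) X k
joinMarks-movedMarks f X k Xk≡f = record { moved = sym Xk≡f ; cleared = cleared ; kept = kept }
  where
  cleared : joinMarks f X k (F.suc k) ≡ false
  cleared with k FP.≟ k
  ... | yes _  = refl
  ... | no k≢k = ⊥-elim (k≢k refl)
  kept : ∀ m → m ≢ k → joinMarks f X k (F.suc m) ≡ X m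
  kept m m≢k with m FP.≟ k
  ... | yes m≡k = ⊥-elim (m≢k m≡k)
  ... | no  _   = refl

singletonR-valid : ∀ {n} (R : Rel n) X f → ValidNCNN R X → ValidNCNN (singletonR R) (singletonMarks f X)
singletonR-valid R X f ((r , s , t) , nc , marks) = (r′ , s′ , t′) , nc′ , marks′
  where
  r′ : ∀ i → T (singletonR R i i)
  r′ F.zero    = tt
  r′ (F.suc i) = r i
  s′ : ∀ i j → T (singletonR R i j) → T (singletonR R j i)
  s′ F.zero    F.zero    p = p
  s′ (F.suc i) (F.suc j) p = s i j p
  t′ : ∀ i j l → T (singletonR R i j) → T (singletonR R j l) → T (singletonR R i l)
  t′ F.zero    F.zero    l         _ p = p
  t′ (F.suc i) (F.suc j) (F.suc l) p q = t i j l p q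
  noEdge : ∀ j → ¬ Edge (singletonR R) F.zero j
  noEdge F.zero    (() , _)
  noEdge (F.suc j) (_ , () , _)
  nc′ : NonCrossing (singletonR R)
  nc′ F.zero    b         c         d         e _ _ _ _ = noEdge b e
  nc′ (F.suc a) (F.suc b) (F.suc c) (F.suc d) e e′ (s≤s a<c) (s≤s c<b) (s≤s b<d) =
    nc a b c d (edge-suc⇐ (singletonR R) a b e) (edge-suc⇐ (singletonR R) c d e′) a<c c<b b<d
  marks′ : ∀ m → T (singletonMarks f X m) → IsMinOfBlock (singletonR R) m × NonNestedBlock (singletonR R) m
  marks′ F.zero    _ = (λ _ _ → z≤n) , λ _ _ _ _ _ _ ()
  marks′ (F.suc m) x = isMin , nonNested
    where
    isMin : IsMinOfBlock (singletonR R) (F.suc m)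
    isMin (F.suc l) p = s≤s (proj₁ (marks m x) l p)
    nonNested : NonNestedBlock (singletonR R) (F.suc m)
    nonNested F.zero    j         M         e _ _ _ _ = noEdge j e
    nonNested (F.suc i) (F.suc j) (F.suc M) e p isMax (s≤s i<m) (s≤s M<j) =
      proj₂ (marks m x) i j M (edge-suc⇐ (singletonR R) i j e) p (λ l q → ℕP.≤-pred (isMax (F.suc l) q)) i<m M<j

module JoinValid {n} (R : Rel n) (X : Fin n → Bool) (k : Fin n) (f : Bool) (valid : ValidNCNN R X)
                 (kIsMin : IsMinOfBlock R k) (cut : Cut R (toℕ k)) (unmarked : ∀ m → toℕ m < toℕ k → X m ≡ false) where

  private
    R⁺ : Rel (suc n)
    R⁺ = joinR R k
    open Blocks R (proj₁ valid)
    nc : NonCrossing R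
    nc = proj₁ (proj₂ valid)
    marks : ∀ m → T (X m) → IsMinOfBlock R m × NonNestedBlock R m
    marks = proj₂ (proj₂ valid)

  equivalence : IsEquivalence R⁺
  equivalence = r′ , s′ , t′
    where
    r′ : ∀ i → T (R⁺ i i)
    r′ F.zero    = tt
    r′ (F.suc i) = R-refl i
    s′ : ∀ i j → T (R⁺ i j) → T (R⁺ j i)
    s′ F.zero    F.zero    p = p
    s′ F.zero    (F.suc j) p = R-sym k j p
    s′ (F.suc i) F.zero    p = R-sym i k p
    s′ (F.suc i) (F.suc j) p = R-sym i j p
    t′ : ∀ i j l → T (R⁺ i j) → T (R⁺ j l) → T (R⁺ i l)
    t′ F.zero    F.zero    l         _ q = q
    t′ F.zero    (F.suc j) F.zero    _ _ = tt
    t′ F.zero    (F.suc j) (F.suc l) p q = R-trans k j l p q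
    t′ (F.suc i) F.zero    F.zero    p _ = p
    t′ (F.suc i) F.zero    (F.suc l) p q = R-trans i k l p q
    t′ (F.suc i) (F.suc j) F.zero    p q = R-trans i j k p q
    t′ (F.suc i) (F.suc j) (F.suc l) p q = R-trans i j l p q

  firstEdge : ∀ j → Edge R⁺ F.zero j → j ≡ F.suc k
  firstEdge F.zero (() , _)
  firstEdge (F.suc j) (_ , r , between) with ℕP.m≤n⇒m<n∨m≡n (kIsMin j r)
  ... | inj₁ k<j = ⊥-elim (between (F.suc k) (s≤s z≤n) (s≤s k<j) (R-refl k))
  ... | inj₂ k≡j = cong F.suc (sym (FP.toℕ-injective k≡j))

  noncrossing : NonCrossing R⁺
  noncrossing F.zero b (F.suc c) (F.suc d) e e′ _ c<b b<d with firstEdge b e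
  ... | refl = false-¬T (cut c d (ℕP.≤-pred c<b) (ℕP.<⇒≤ (ℕP.≤-pred b<d))) (proj₁ (proj₂ e′))
  noncrossing (F.suc a) (F.suc b) (F.suc c) (F.suc d) e e′ (s≤s a<c) (s≤s c<b) (s≤s b<d) =
    nc a b c d (edge-suc⇐ R⁺ a b e) (edge-suc⇐ R⁺ c d e′) a<c c<b b<d

  -- A marked block other than k's lies after k, away from the new arch.
  laterMark : ∀ m → m ≢ k → T (X m) → IsMinOfBlock R⁺ (F.suc m) × NonNestedBlock R⁺ (F.suc m)
  laterMark m m≢k x = isMin , nonNested
    where
    k<m : toℕ k < toℕ m
    k<m with ℕP.<-cmp (toℕ k) (toℕ m)
    ... | tri< k<m _ _ = k<m
    ... | tri≈ _ k≡m _ = ⊥-elim (m≢k (sym (FP.toℕ-injective k≡m)))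
    ... | tri> _ _ m<k = ⊥-elim (false-¬T (unmarked m m<k) x)
    notWithK : ¬ T (R m k)
    notWithK r = ℕP.<⇒≱ k<m (proj₁ (marks m x) k r)
    isMin : IsMinOfBlock R⁺ (F.suc m)
    isMin F.zero    r = ⊥-elim (notWithK r)
    isMin (F.suc l) r = s≤s (proj₁ (marks m x) l r)
    nonNested : NonNestedBlock R⁺ (F.suc m)
    nonNested F.zero j M e r _ _ M<j with firstEdge j e
    ... | refl = ℕP.<⇒≱ k<m (ℕP.<⇒≤ (ℕP.≤-trans (isMin M r) (ℕP.≤-pred M<j)))
    nonNested (F.suc i) F.zero    M         (() , _)
    nonNested (F.suc i) (F.suc j) F.zero    e r = ⊥-elim (notWithK r)
    nonNested (F.suc i) (F.suc j) (F.suc M) e r isMax (s≤s i<m) (s≤s M<j) =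
      proj₂ (marks m x) i j M (edge-suc⇐ R⁺ i j e) r (λ l r′ → ℕP.≤-pred (isMax (F.suc l) r′)) i<m M<j

  -- The mark f of the enlarged first block is legal: nothing lies before it.
  joinR-valid : ValidNCNN R⁺ (joinMarks f X k)
  joinR-valid = equivalence , noncrossing , marks′
    where
    marks′ : ∀ m → T (joinMarks f X k m) → IsMinOfBlock R⁺ m × NonNestedBlock R⁺ m
    marks′ F.zero    _ = (λ _ _ → z≤n) , λ _ _ _ _ _ _ ()
    marks′ (F.suc m) x with m FP.≟ k
    ... | no m≢k = laterMark m m≢k x

split-injective : ∀ {A : Set} (xs xs′ : List A) {y y′ ys ys′} → xs ++ y ∷ ys ≡ xs′ ++ y′ ∷ ys′ →
  length xs ≡ length xs′ → (xs ≡ xs′) × (y ≡ y′) × (ys ≡ ys′)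
split-injective []       []         eq _   = refl , LP.∷-injectiveˡ eq , LP.∷-injectiveʳ eq
split-injective (x ∷ xs) (x′ ∷ xs′) eq len with LP.∷-injective eq
... | refl , eq′ with split-injective xs xs′ eq′ (ℕP.suc-injective len)
...   | refl , y≡ , ys≡ = refl , y≡ , ys≡

IsMinKind-isMin : ∀ mn mx → IsMinKind (kindFrom mn mx) → mn ≡ true
IsMinKind-isMin true  mx    _ = refl
IsMinKind-isMin false true  ()
IsMinKind-isMin false false ()

Preimage : ℕ → Word → Set
Preimage n w = Σ (Rel n) λ R → Σ (Fin n → Bool) λ X → ValidNCNN R X × word R X ≡ w

-- If u ++ (κ , b) ∷ v is the word of (σ,X), with u balanced and unflipped and κ
-- the kind of a minimum, then joining a new first element to the block at
-- position |u| (and moving its mark there) produces the join word.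
joinPreimage : ∀ {n} b u κ v → Balanced u → Unflipped u → IsMinKind κ →
  Preimage n (u ++ (κ , b) ∷ v) → Preimage (suc n) (joinWord b u (κ , b) v)
joinPreimage {n} b u κ v bal unf min (R , X , valid , wordEq) = joinR R k , joinMarks b X k , joinR-valid , wordEq⁺
  where
  module Facts = PrefixFacts (prefixFacts n R X valid)
  u<n : length u < n
  u<n = subst (length u <_) (trans (cong length (sym wordEq)) (LP.length-tabulate (letter R X)))
              (subst (length u <_) (sym (LP.length-++ u)) (ℕP.m<m+n (length u) (s≤s z≤n)))
  k : Fin n
  k = F.fromℕ< u<n
  parts : (take (toℕ k) (word R X) ≡ u) × (letter R X k ≡ (κ , b)) × (drop (suc (toℕ k)) (word R X) ≡ v)
  parts = split-injective (take (toℕ k) (word R X)) u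
            (trans (sym (tabulate-split k (letter R X))) wordEq)
            (trans (length-take-tabulate k (letter R X)) (FP.toℕ-fromℕ< u<n))
  u≡ : take (toℕ k) (word R X) ≡ u
  u≡ = proj₁ parts
  x≡ : letter R X k ≡ (κ , b)
  x≡ = proj₁ (proj₂ parts)
  v≡ : drop (suc (toℕ k)) (word R X) ≡ v
  v≡ = proj₂ (proj₂ parts)
  kIsMin : IsMinOfBlock R k
  kIsMin = isMinᵇ⇒ R k (true-T (IsMinKind-isMin (isMinᵇ R k) (isMaxᵇ R k) (subst IsMinKind (sym (cong proj₁ x≡)) min)))
  -- Marked blocks before k would flip letters of u.
  unmarked : ∀ m → toℕ m < toℕ k → X m ≡ false
  unmarked m m<k = T-false (λ t → false-¬T unflipped (true-T (Facts.marked⇒flipped m t)))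
    where unflipped : proj₂ (letter R X m) ≡ false
          unflipped = All-take-tabulate⇒ (letter R X) (toℕ k) (subst Unflipped (sym u≡) unf) m m<k
  Xk≡b : X k ≡ b
  Xk≡b = trans (sym (flipParity-first R X k (proj₁ (proj₁ valid) k) unmarked)) (cong proj₂ x≡)
  open JoinValid R X k b valid kIsMin (Facts.balanced⇒cut (toℕ k) (trans (cong (run ground) u≡) bal)) unmarked
    using (joinR-valid)
  wordEq⁺ : word (joinR R k) (joinMarks b X k) ≡ joinWord b u (κ , b) v
  wordEq⁺ = begin
    word (joinR R k) (joinMarks b X k)
      ≡⟨ JoinedFirstWord.word-joinedFirst (joinR R k) (joinMarks b X k) X k (proj₁ valid)
           (record { self = refl ; joins = λ _ → refl ; joins′ = λ _ → refl ; kIsMin = kIsMin })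
           (joinMarks-movedMarks b X k Xk≡b) ⟩
    joinWord (X k) (take (toℕ k) (word R X)) (letter R X k) (drop (suc (toℕ k)) (word R X))
      ≡⟨ cong₂ (λ c (p : Word × Letter × Word) → joinWord c (proj₁ p) (proj₁ (proj₂ p)) (proj₂ (proj₂ p)))
               Xk≡b (cong₂ _,_ u≡ (cong₂ _,_ x≡ v≡)) ⟩
    joinWord b u (κ , b) v ∎
    where open ≡-Reasoning

-- Every balanced word of length n is the word of some (σ,X): read off the first
-- letter; a singleton adds a singleton block, an opener is undone by archExit.
word-surjective : ∀ n w → length w ≡ n → Balanced w → Preimage n w
word-surjective zero [] refl _ = (λ ()) , (λ ()) , (((λ ()) , (λ ()) , (λ ())) , (λ ()) , (λ ())) , refl
word-surjective (suc n) ((closer , f) ∷ w) _ bal with trans (sym bal) (run-dead w)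
... | ()
word-surjective (suc n) ((inner , f) ∷ w) _ bal with trans (sym bal) (run-dead w)
... | ()
word-surjective (suc n) ((singleton , f) ∷ w) len bal with word-surjective n w (ℕP.suc-injective len) bal
... | R , X , valid , wordEq = singletonR R , singletonMarks f X , singletonR-valid R X f valid ,
      trans (word-singletonFirst (singletonR R) (singletonMarks f X) singletonFirst) (cong ((singleton , f) ∷_) wordEq)
  where singletonFirst : SingletonFirst (singletonR R)
        singletonFirst = record { self = refl ; alone = λ _ → refl ; alone′ = λ _ → refl }
word-surjective (suc n) ((opener , f) ∷ w) len bal =
  subst (Preimage (suc n)) (cong ((opener , f) ∷_) (sym split))
        (joinPreimage f u κ v insideRun insideUnflipped minKind (word-surjective n w′ length-w′ w′-balanced))
  where
  open ArchExit (archExit 0 f w bal) renaming (inside to u; kind to κ; outside to v)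
  w′ : Word
  w′ = u ++ (κ , f) ∷ v
  length-w′ : length w′ ≡ n
  length-w′ = begin
    length (u ++ (κ , f) ∷ v)                        ≡⟨ LP.length-++ u ⟩
    length u + suc (length v)                        ≡⟨ cong (_+ suc (length v)) (sym (LP.length-map (flipBy f) u)) ⟩
    length (map (flipBy f) u) + suc (length v)       ≡⟨ sym (LP.length-++ (map (flipBy f) u)) ⟩
    length (map (flipBy f) u ++ loseMin (κ , f) ∷ v) ≡⟨ cong length (sym split) ⟩
    length w                                         ≡⟨ ℕP.suc-injective len ⟩
    n                                                ∎
    where open ≡-Reasoning
  w′-balanced : Balanced w′
  w′-balanced = trans (run-++ ground u ((κ , f) ∷ v)) (trans (cong (λ s → run s ((κ , f) ∷ v)) insideRun) outsideBalanced)

word-balanced : ∀ n (R : Rel n) X → ValidNCNN R X → Balanced (word R X)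
word-balanced n R X valid = subst Balanced (LP.take-all n (word R X) (ℕP.≤-reflexive (LP.length-tabulate (letter R X))))
  (PrefixFacts.cut⇒balanced (prefixFacts n R X valid) n ℕP.≤-refl (λ _ j _ n≤j → ⊥-elim (ℕP.<⇒≱ (FP.toℕ<n j) n≤j)))

-- g lands in LP(n): its path has 2n steps, n of them up since the word is balanced.
g-intoLP : ∀ n (R : Rel n) (X : Fin n → Bool) → ValidNCNN R X → InLP n (g R X)
g-intoLP n R X valid =
  trans (cong length (g-word R X)) (trans (length-wordPath (word R X)) (cong₂ _+_ lengthWord lengthWord)) ,
  trans (cong countU (g-word R X)) (trans (countU-balanced (word R X) (word-balanced n R X valid)) lengthWord)
  where lengthWord : length (word R X) ≡ n
        lengthWord = LP.length-tabulate (letter R X)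

-- g is injective: paths determine live words, and words determine partitions.
g-injective : ∀ n (R R′ : Rel n) (X X′ : Fin n → Bool) → ValidNCNN R X → ValidNCNN R′ X′ →
  g R X ≡ g R′ X′ → ((i j : Fin n) → R i j ≡ R′ i j) × ((i : Fin n) → X i ≡ X′ i)
g-injective n R R′ X X′ valid valid′ eq = word-injective n R R′ X X′ valid valid′
  (wordPath-injective (word R X) (word R′ X′)
    (balanced-alive {word R X} (word-balanced n R X valid))
    (balanced-alive {word R′ X′} (word-balanced n R′ X′ valid′))
    (trans (sym (g-word R X)) (trans eq (g-word R′ X′))))

-- g is surjective: decoding a path of LP(n) gives a live word with n up-steps,
-- hence a balanced one, which is the word of some (σ,X).
g-surjective : ∀ n (p : Path) → InLP n p → ∃[ R ] ∃[ X ] (ValidNCNN {n} R X × g R X ≡ p)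
g-surjective n p (lengthP , countP) with decode-sound n ground p (λ ()) lengthP
... | pathEq , lengthW , alive
  with word-surjective n (decode ground p) lengthW
         (balanced-countU (decode ground p) alive (trans (cong countU pathEq) (trans countP (sym lengthW))))
... | R , X , valid , wordEq = R , X , valid , trans (g-word R X) (trans (cong wordPath wordEq) pathEq)

-- Proposition 7.2.
proposition7p2 : (n : ℕ) → 1 ≤ n →
    -- g maps NC^NN(n) into LP(n)
    ((R : Rel n) (X : Fin n → Bool) → ValidNCNN R X → InLP n (g R X)) ×
    -- g is injective on NC^NN(n)
    ((R R′ : Rel n) (X X′ : Fin n → Bool) → ValidNCNN R X → ValidNCNN R′ X′ →
      g R X ≡ g R′ X′ →
      ((i j : Fin n) → R i j ≡ R′ i j) × ((i : Fin n) → X i ≡ X′ i)) ×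
    -- g is surjective onto LP(n)
    ((p : Path) → InLP n p →
      ∃[ R ] ∃[ X ] (ValidNCNN {n} R X × g R X ≡ p))
proposition7p2 n _ = g-intoLP n , g-injective n , g-surjective n
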